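{- Let $\mathcal{G}$ be a finite connected graph whose vertices carry positive populations, let $k\ge 1$ be an integer, and let $\mathcal{I}=\mathrm{pop}(\mathcal{G})/k$. Suppose at least one partition of $V(\mathcal{G})$ into $k$ sets, each inducing a connected subgraph of population exactly $\mathcal{I}$, exists. Run the Complete Cut algorithm on $(\mathcal{G},k)$. Then for every partition $\mathcal{P}=\{D_1,\dots,D_k\}$ of $V(\mathcal{G})$ into $k$ sets, each inducing a connected subgraph of population exactly $\mathcal{I}$, the probability that Complete Cut outputs $\mathcal{P}$ is $$\mathrm{Prob}(\mathcal{P}) = \frac{1}{Z}\,\mathrm{ST}(\mathcal{G}/\mathcal{P})\cdot\prod_{i=1}^k \mathrm{ST}(D_i),$$ where $Z$ is the sum of $\mathrm{ST}(\mathcal{G}/\mathcal{P}')\prod_{i}\mathrm{ST}(D'_i)$ over all such partitions $\mathcal{P}'=\{D'_1,\dots,D'_k\}$; i.e. $\mathrm{Prob}(\mathcal{P})$ is proportional to $\mathrm{ST}(\mathcal{G}/\mathcal{P})\prod_{i=1}^k \mathrm{ST}(D_i)$.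
   Context: $\mathrm{pop}$ of a vertex set is the sum of the populations of its vertices. For a graph $H$, $\mathrm{ST}(H)$ denotes its number of spanning trees (with $D_i$ identified with the subgraph of $\mathcal{G}$ it induces). The quotient multigraph $\mathcal{G}/\mathcal{P}$ has one vertex for each $D_i$, and the number of (parallel) edges between the vertices for $D_i$ and $D_j$ ($i\ne j$) equals the number of edges of $\mathcal{G}$ with one endpoint in $D_i$ and the other in $D_j$ (edges inside a district are discarded). An edge $e$ of a spanning tree $T$ of $\mathcal{G}$ is a valid cut edge if removing $e$ from $T$ splits $T$ into two subtrees whose populations are both integer multiples of $\mathcal{I}$. The Complete Cut algorithm: repeatedly draw a uniformly random spanning tree $T$ of $\mathcal{G}$ (independently each time) until $T$ has exactly $k-1$ valid cut edges; then remove these $k-1$ edges from $T$ and output the vertex sets of the $k$ resulting components as the partition. -}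

module Defs where

open import Data.Nat using (ℕ; zero; suc; _+_; _*_; _∸_; _<_)
open import Data.Fin using (Fin; _≟_) renaming (_<_ to _<ᶠ_)
open import Data.Fin.Subset using (Subset; _∈_)
open import Data.Vec using (Vec; lookup)
open import Data.List using (List; length; map; allFin)
open import Data.Nat.ListAction using (sum; product)
open import Data.List.Membership.Propositional using () renaming (_∈_ to _∈ₗ_)
open import Data.List.Relation.Unary.Unique.Propositional using (Unique)
open import Data.List.Relation.Unary.All using (All)
open import Data.Product using (Σ; ∃; _×_; _,_; proj₁; proj₂; swap)
open import Data.Sum using (_⊎_)
open import Data.Bool using (if_then_else_)
open import Data.Unit using (⊤)
open import Relation.Nullary using (¬_; does)
open import Relation.Binary.PropositionalEquality using (_≡_; _≢_)

Iff : Set → Set → Set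
Iff A B = (A → B) × (B → A)

-- "the number of elements a of A with P a is c" : there is a duplicate-free
-- list of exactly the elements satisfying P, of length c.
-- (Proof-irrelevant: counts elements, not proofs of P.)
Count : {A : Set} → (A → Set) → ℕ → Set
Count {A} P c =
  Σ (List A) λ xs → Unique xs × (∀ a → Iff (P a) (a ∈ₗ xs)) × length xs ≡ c

-- (Multi)graphs: vertex set Fin n, edge set Fin m, endpoints given by ends.

Ends : ℕ → ℕ → Set
Ends n m = Fin m → Fin n × Fin n

Adj : {n : ℕ} → Fin n × Fin n → Fin n → Fin n → Set
Adj (x , y) u v = (u ≡ x × v ≡ y) ⊎ (u ≡ y × v ≡ x)

data Reach {n m : ℕ} (ends : Ends n m) (P : Fin m → Set) : Fin n → Fin n → Set where
  here : ∀ {u} → Reach ends P u u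
  step : ∀ {u v w} (e : Fin m) → P e → Adj (ends e) u v → Reach ends P v w →
         Reach ends P u w

Spans : {n m : ℕ} → Ends n m → (Fin n → Set) → (Fin m → Set) → Set
Spans {n} ends V P = ∀ (u v : Fin n) → V u → V v → Reach ends P u v

-- Spanning tree of the graph H with vertex set V and edge set Allowed
-- (edges of H connect vertices of V): a set S of edges of H which spans V
-- and is minimal with this property (i.e. a minimally connected spanning
-- subgraph = spanning tree).
IsSpanningTree : {n m : ℕ} → Ends n m → (Fin n → Set) → (Fin m → Set) →
                 Subset m → Set
IsSpanningTree ends V Allowed S =
  (∀ e → e ∈ S → Allowed e) ×
  Spans ends V (λ e → e ∈ S) ×
  (∀ e → e ∈ S → ¬ Spans ends V (λ f → f ∈ S × f ≢ e))

STCount : {n m : ℕ} → Ends n m → (Fin n → Set) → (Fin m → Set) → ℕ → Set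
STCount ends V Allowed c = Count (IsSpanningTree ends V Allowed) c

All⊤ : {A : Set} → A → Set
All⊤ _ = ⊤

Simple : {n m : ℕ} → Ends n m → Set
Simple ends =
  (∀ e → proj₁ (ends e) ≢ proj₂ (ends e)) ×
  (∀ e f → e ≢ f → ends e ≢ ends f × ends e ≢ swap (ends f))

Connected : {n m : ℕ} → Ends n m → Set
Connected ends = Spans ends All⊤ All⊤

popTotal : {n : ℕ} → (Fin n → ℕ) → ℕ
popTotal {n} pop = sum (map pop (allFin n))

popSub : {n : ℕ} → (Fin n → ℕ) → Subset n → ℕ
popSub {n} pop C = sum (map (λ v → if lookup C v then pop v else 0) (allFin n))

-- Partitions into k districts, represented by a canonical labelling
-- L : Vec (Fin k) n  (district of v is lookup L v); canonical means labels
-- appear in order of first occurrence, so each unordered partition into k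
-- nonempty blocks has exactly one representation.

module _ {n m k : ℕ} (ends : Ends n m) (pop : Fin n → ℕ) (L : Vec (Fin k) n) where

  InDistrict : Fin k → Fin n → Set
  InDistrict i v = lookup L v ≡ i

  InsideDistrict : Fin k → Fin m → Set
  InsideDistrict i e = InDistrict i (proj₁ (ends e)) × InDistrict i (proj₂ (ends e))

  districtPop : Fin k → ℕ
  districtPop i = sum (map (λ v → if does (lookup L v ≟ i) then pop v else 0) (allFin n))

  -- quotient multigraph G/P : vertices Fin k, edges = edges of G joining
  -- different districts, with endpoints the districts of their endpoints
  quotEnds : Ends k m
  quotEnds e = lookup L (proj₁ (ends e)) , lookup L (proj₂ (ends e))

  Crossing : Fin m → Set
  Crossing e = lookup L (proj₁ (ends e)) ≢ lookup L (proj₂ (ends e))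

  ValidPartition : Set
  ValidPartition =
    (∀ i → ∃ λ v → InDistrict i v) ×
    (∀ (i j : Fin k) → i <ᶠ j → ∀ v → InDistrict j v →
        ∃ λ u → u <ᶠ v × InDistrict i u) ×
    (∀ i → Spans ends (InDistrict i) (InsideDistrict i)) ×
    (∀ i → districtPop i * k ≡ popTotal pop)

  Weight : ℕ → Set
  Weight w = Σ ℕ λ wq → Σ (Fin k → ℕ) λ wd →
    STCount quotEnds All⊤ Crossing wq ×
    (∀ i → STCount ends (InDistrict i) (InsideDistrict i) (wd i)) ×
    w ≡ wq * product (map wd (allFin k))

IsZ : {n m : ℕ} → Ends n m → (Fin n → ℕ) → (k : ℕ) → ℕ → Set
IsZ {n} ends pop k Z =
  Σ (List (Vec (Fin k) n × ℕ)) λ xs →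
    Unique (map proj₁ xs) ×
    (∀ L → Iff (ValidPartition ends pop L) (L ∈ₗ map proj₁ xs)) ×
    All (λ p → Weight ends pop (proj₁ p) (proj₂ p)) xs ×
    Z ≡ sum (map proj₂ xs)

module _ {n m : ℕ} (ends : Ends n m) (pop : Fin n → ℕ) (k : ℕ) where

  ComponentIs : (Fin m → Set) → Fin n → Subset n → Set
  ComponentIs P x C = ∀ v → Iff (v ∈ C) (Reach ends P x v)

  MultipleOfI : ℕ → Set
  MultipleOfI p = ∃ λ t → p * k ≡ t * popTotal pop

  ValidCut : Subset m → Fin m → Set
  ValidCut T e =
    e ∈ T ×
    (∀ C → ComponentIs (λ f → f ∈ T × f ≢ e) (proj₁ (ends e)) C →
       MultipleOfI (popSub pop C)) ×
    (∀ C → ComponentIs (λ f → f ∈ T × f ≢ e) (proj₂ (ends e)) C →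
       MultipleOfI (popSub pop C))

  Accepted : Subset m → Set
  Accepted T = IsSpanningTree ends All⊤ All⊤ T × Count (ValidCut T) (k ∸ 1)

  Outputs : Subset m → Vec (Fin k) n → Set
  Outputs T L = ∀ u v →
    Iff (Reach ends (λ f → f ∈ T × ¬ ValidCut T f) u v) (lookup L u ≡ lookup L v)

-- An accepted spanning tree T outputs the partition P exactly when T restricted to the edges between
-- districts is a spanning tree of G/P and T restricted to each district D_i is a spanning tree of D_i:
-- cutting an edge between districts leaves two sides that are unions of districts, while cutting an
-- edge inside D_i leaves a piece of D_i whose population lies strictly between 0 and I. So the trees
-- outputting P number ST(G/P) ∏ ST(D_i). Conversely, removing the k − 1 valid cut edges of an
-- accepted tree leaves k components whose populations are positive multiples of I adding up to k I,
-- so every accepted tree outputs a valid partition, and the accepted trees number Z in total.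
module Submission where

open import Defs
open import Data.Nat using (ℕ; zero; suc; _+_; _*_; _∸_; _≤_; _<_; _<?_; z≤n; s≤s; s≤s⁻¹; NonZero; >-nonZero; >-nonZero⁻¹)
open import Data.Nat.Properties
open import Data.Fin using (Fin; zero; suc; toℕ; fromℕ<) renaming (_≟_ to _≟ᶠ_; _<_ to _<ᶠ_; _≤_ to _≤ᶠ_)
import Data.Fin.Properties as Fin
open import Data.Fin.Subset using (Subset; _∈_; _∉_; _∪_; ⊥; ⁅_⁆)
open import Data.Fin.Subset.Properties using (_∈?_; ⊆-antisym; x∈p∪q⁺; x∈p∪q⁻; ∉⊥; x∈⁅x⁆; x∈⁅y⁆⇒x≡y)
open import Data.Vec using (Vec; lookup; tabulate)
open import Data.Vec.Properties using (lookup∘tabulate; []=⇒lookup; lookup⇒[]=; tabulate∘lookup; tabulate-cong)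
open import Data.Bool using (Bool; true; false; if_then_else_)
open import Data.List using (List; []; _∷_; _++_; map; length; allFin; filter; cartesianProductWith)
import Data.List as List
open import Data.List.Properties using (length-++; length-map; map-tabulate)
open import Data.Nat.ListAction using (sum; product)
open import Data.Nat.ListAction.Properties using (product≢0)
open import Data.List.Membership.Propositional using () renaming (_∈_ to _∈ₗ_)
open import Data.List.Membership.Propositional.Properties using (∈-allFin; ∈-filter⁺; ∈-filter⁻; ∈-map⁺; ∈-map⁻; ∈-++⁺ˡ; ∈-++⁺ʳ; ∈-++⁻; ∈-cartesianProductWith⁺; ∈-cartesianProductWith⁻)
open import Data.List.Membership.Propositional.Properties.WithK using (unique∧set⇒bag)
open import Data.List.Relation.Binary.BagAndSetEquality using (∼bag⇒↭)
open import Data.List.Relation.Binary.Permutation.Propositional.Properties using (↭-length)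
open import Data.List.Relation.Unary.Any using (here; there; any?)
open import Data.List.Relation.Unary.All as All using (All; []; _∷_)
open import Data.List.Relation.Unary.All.Properties using (map⁺; tabulate⁺)
open import Data.List.Relation.Unary.Unique.Propositional using (Unique; []; _∷_)
open import Data.List.Relation.Unary.Unique.Propositional.Properties using (allFin⁺; filter⁺; ++⁺)
open import Data.Product using (Σ; ∃; ∃₂; _×_; _,_; proj₁; proj₂; swap)
open import Data.Sum using (_⊎_; inj₁; inj₂; [_,_]′; map₁)
open import Data.Empty using (⊥-elim) renaming (⊥ to Empty)
open import Data.Unit using (tt)
open import Function using (_∘_; _$_; id; mk⇔)
open import Relation.Nullary using (¬_; Dec; yes; no; does; _×-dec_; ¬?)
open import Relation.Nullary.Decidable using (dec-true; dec-false; does-⇔)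
open import Relation.Unary using (Decidable)
open import Relation.Binary using (tri<; tri≈; tri>)
open import Relation.Binary.PropositionalEquality
open import Algebra.Properties.Semiring.Sum +-*-semiring using (sum-cong-≗; sum-replicate-zero; ∑-distrib-+; ∑-comm; *-distribʳ-sum) renaming (sum to ∑)

-- Finite sums, cardinalities and counting

private
  variable
    A B C I : Set

onlyIf : Bool → ℕ → ℕ
onlyIf b c = if b then c else 0

onlyIf-≤ : ∀ b c → onlyIf b c ≤ c
onlyIf-≤ true c = ≤-refl
onlyIf-≤ false c = z≤n

does-iff : {P Q : Set} → Iff P Q → (p? : Dec P) (q? : Dec Q) → does p? ≡ does q?
does-iff (to , from) = does-⇔ (mk⇔ to from)

sum-map-allFin : ∀ {n} (f : Fin n → ℕ) → sum (map f (allFin n)) ≡ ∑ f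
sum-map-allFin f = trans (cong sum (map-tabulate id f)) (sum-tabulate f)
  where
  sum-tabulate : ∀ {n} (g : Fin n → ℕ) → sum (List.tabulate g) ≡ ∑ g
  sum-tabulate {zero} g = refl
  sum-tabulate {suc n} g = cong (g zero +_) (sum-tabulate (g ∘ suc))

∑-one : ∀ n → ∑ {n} (λ _ → 1) ≡ n
∑-one zero = refl
∑-one (suc n) = cong suc (∑-one n)

∑-zero : ∀ {n} {f : Fin n → ℕ} → (∀ i → f i ≡ 0) → ∑ f ≡ 0
∑-zero {n} f≡0 = trans (sum-cong-≗ f≡0) (sum-replicate-zero n)

∑-indicator : ∀ {n} (j : Fin n) c → ∑ (λ i → onlyIf (does (i ≟ᶠ j)) c) ≡ c
∑-indicator {suc n} zero c = trans (cong (c +_) (∑-zero {n} (λ _ → refl))) (+-identityʳ c)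
∑-indicator {suc n} (suc j) c = ∑-indicator j c

∑-term-≤ : ∀ {n} (f : Fin n → ℕ) j → f j ≤ ∑ f
∑-term-≤ f zero = m≤m+n _ _
∑-term-≤ f (suc j) = ≤-trans (∑-term-≤ (f ∘ suc) j) (m≤n+m _ _)

∑-mono-≤ : ∀ {n} {f g : Fin n → ℕ} → (∀ i → f i ≤ g i) → ∑ f ≤ ∑ g
∑-mono-≤ {zero} f≤g = z≤n
∑-mono-≤ {suc n} f≤g = +-mono-≤ (f≤g zero) (∑-mono-≤ (f≤g ∘ suc))

∑-update : ∀ {n} (f g : Fin n → ℕ) j → (∀ i → i ≢ j → f i ≡ g i) → ∑ f + g j ≡ ∑ g + f j
∑-update f g zero f≡g = begin
  f zero + ∑ (f ∘ suc) + g zero  ≡⟨ cong (λ s → f zero + s + g zero) (sum-cong-≗ (λ i → f≡g (suc i) λ ())) ⟩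
  f zero + ∑ (g ∘ suc) + g zero  ≡⟨ +-comm (f zero + _) (g zero) ⟩
  g zero + (f zero + ∑ (g ∘ suc)) ≡⟨ cong (g zero +_) (+-comm (f zero) _) ⟩
  g zero + (∑ (g ∘ suc) + f zero) ≡⟨ +-assoc (g zero) _ _ ⟨
  g zero + ∑ (g ∘ suc) + f zero  ∎
  where open ≡-Reasoning
∑-update f g (suc j) f≡g = begin
  f zero + ∑ (f ∘ suc) + g (suc j)   ≡⟨ +-assoc (f zero) _ _ ⟩
  f zero + (∑ (f ∘ suc) + g (suc j)) ≡⟨ cong₂ _+_ (f≡g zero λ ()) (∑-update (f ∘ suc) (g ∘ suc) j (λ i i≢j → f≡g (suc i) (i≢j ∘ Fin.suc-injective))) ⟩
  g zero + (∑ (g ∘ suc) + f (suc j)) ≡⟨ +-assoc (g zero) _ _ ⟨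
  g zero + ∑ (g ∘ suc) + f (suc j)   ∎
  where open ≡-Reasoning

∑-mono-gap : ∀ {n} {f g : Fin n → ℕ} j c → (∀ i → f i ≤ g i) → f j + c ≤ g j → ∑ f + c ≤ ∑ g
∑-mono-gap {f = f} {g} zero c f≤g fj+c≤gj = begin
  f zero + ∑ (f ∘ suc) + c   ≡⟨ +-assoc (f zero) _ c ⟩
  f zero + (∑ (f ∘ suc) + c) ≡⟨ cong (f zero +_) (+-comm _ c) ⟩
  f zero + (c + ∑ (f ∘ suc)) ≡⟨ +-assoc (f zero) c _ ⟨
  f zero + c + ∑ (f ∘ suc)   ≤⟨ +-mono-≤ fj+c≤gj (∑-mono-≤ (f≤g ∘ suc)) ⟩
  g zero + ∑ (g ∘ suc)       ∎
  where open ≤-Reasoning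
∑-mono-gap {f = f} {g} (suc j) c f≤g fj+c≤gj = begin
  f zero + ∑ (f ∘ suc) + c   ≡⟨ +-assoc (f zero) _ c ⟩
  f zero + (∑ (f ∘ suc) + c) ≤⟨ +-mono-≤ (f≤g zero) (∑-mono-gap j c (f≤g ∘ suc) fj+c≤gj) ⟩
  g zero + ∑ (g ∘ suc)       ∎
  where open ≤-Reasoning

∑-pointwise-≡ : ∀ {n} {f g : Fin n → ℕ} → (∀ i → f i ≤ g i) → ∑ f ≡ ∑ g → ∀ i → f i ≡ g i
∑-pointwise-≡ {f = f} {g} f≤g ∑f≡∑g j with m≤n⇒m<n∨m≡n (f≤g j)
... | inj₂ fj≡gj = fj≡gj
... | inj₁ fj<gj = ⊥-elim (<-irrefl ∑f≡∑g (begin-strict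
  ∑ f     <⟨ m<m+n (∑ f) (s≤s z≤n) ⟩
  ∑ f + 1 ≤⟨ ∑-mono-gap j 1 f≤g (subst (_≤ g j) (+-comm 1 (f j)) fj<gj) ⟩
  ∑ g     ∎))
  where open ≤-Reasoning

∑-fibres : ∀ {n k} (lab : Fin n → Fin k) (h : Fin n → ℕ) →
  ∑ h ≡ ∑ (λ r → ∑ (λ v → onlyIf (does (lab v ≟ᶠ r)) (h v)))
∑-fibres lab h = begin
  ∑ h                                                   ≡⟨ sum-cong-≗ (λ v → ∑-indicator (lab v) (h v)) ⟨
  ∑ (λ v → ∑ (λ r → onlyIf (does (r ≟ᶠ lab v)) (h v))) ≡⟨ sum-cong-≗ (λ v → sum-cong-≗ (λ r → cong (λ b → onlyIf b (h v)) (does-iff (sym , sym) (r ≟ᶠ lab v) (lab v ≟ᶠ r)))) ⟩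
  ∑ (λ v → ∑ (λ r → onlyIf (does (lab v ≟ᶠ r)) (h v))) ≡⟨ ∑-comm (λ v r → onlyIf (does (lab v ≟ᶠ r)) (h v)) ⟩
  ∑ (λ r → ∑ (λ v → onlyIf (does (lab v ≟ᶠ r)) (h v))) ∎
  where open ≡-Reasoning

card : ∀ {N} {P : Fin N → Set} → Decidable P → ℕ
card P? = ∑ (λ a → onlyIf (does (P? a)) 1)

onlyIf-does-mono : {X Y : Set} (x? : Dec X) (y? : Dec Y) → (X → Y) → onlyIf (does x?) 1 ≤ onlyIf (does y?) 1
onlyIf-does-mono (no _) _ _ = z≤n
onlyIf-does-mono (yes _) (yes _) _ = ≤-refl
onlyIf-does-mono (yes x) (no ¬y) x→y = ⊥-elim (¬y (x→y x))

module _ {N : ℕ} {P Q : Fin N → Set} (P? : Decidable P) (Q? : Decidable Q) where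

  card-cong : (∀ a → Iff (P a) (Q a)) → card P? ≡ card Q?
  card-cong P⇔Q = sum-cong-≗ (λ a → cong (λ b → onlyIf b 1) (does-iff (P⇔Q a) (P? a) (Q? a)))

  card-mono : (∀ a → P a → Q a) → card P? ≤ card Q?
  card-mono P⊆Q = ∑-mono-≤ (λ a → onlyIf-does-mono (P? a) (Q? a) (P⊆Q a))

  card-insert : ∀ x → (∀ a → a ≢ x → Iff (P a) (Q a)) → ¬ P x → Q x → card P? + 1 ≡ card Q?
  card-insert x P⇔Q ¬Px Qx = begin
    card P? + 1                        ≡⟨ cong (λ b → card P? + onlyIf b 1) (dec-true (Q? x) Qx) ⟨
    card P? + onlyIf (does (Q? x)) 1   ≡⟨ ∑-update _ _ x (λ a a≢x → cong (λ b → onlyIf b 1) (does-iff (P⇔Q a a≢x) (P? a) (Q? a))) ⟩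
    card Q? + onlyIf (does (P? x)) 1   ≡⟨ cong (λ b → card Q? + onlyIf b 1) (dec-false (P? x) ¬Px) ⟩
    card Q? + 0                        ≡⟨ +-identityʳ _ ⟩
    card Q?                            ∎
    where open ≡-Reasoning

  card-< : ∀ x → (∀ a → P a → Q a) → ¬ P x → Q x → card P? + 1 ≤ card Q?
  card-< x P⊆Q ¬Px Qx = ∑-mono-gap x 1 (λ a → onlyIf-does-mono (P? a) (Q? a) (P⊆Q a))
    (subst₂ (λ b b′ → onlyIf b 1 + 1 ≤ onlyIf b′ 1) (sym (dec-false (P? x) ¬Px)) (sym (dec-true (Q? x) Qx)) ≤-refl)

card-∅ : ∀ {N} {P : Fin N → Set} (P? : Decidable P) → (∀ a → ¬ P a) → card P? ≡ 0
card-∅ P? ¬P = ∑-zero (λ a → cong (λ b → onlyIf b 1) (dec-false (P? a) (¬P a)))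

card-all : ∀ N → card {N} {All⊤} (λ _ → yes tt) ≡ N
card-all N = ∑-one N

count-cong : {P Q : A → Set} {c : ℕ} → Count P c → (∀ a → Iff (P a) (Q a)) → Count Q c
count-cong (xs , xs! , P⇔xs , len) P⇔Q =
  xs , xs! , (λ a → proj₁ (P⇔xs a) ∘ proj₂ (P⇔Q a) , proj₁ (P⇔Q a) ∘ proj₂ (P⇔xs a)) , len

-- two duplicate-free lists with the same members are permutations of each other
count-unique : {P Q : A → Set} {c d : ℕ} → Count P c → Count Q d → (∀ a → Iff (P a) (Q a)) → c ≡ d
count-unique (xs , xs! , P⇔xs , refl) (ys , ys! , Q⇔ys , refl) P⇔Q =
  ↭-length (∼bag⇒↭ (unique∧set⇒bag xs! ys! λ {a} →
    mk⇔ (proj₁ (Q⇔ys a) ∘ proj₁ (P⇔Q a) ∘ proj₂ (P⇔xs a)) (proj₁ (P⇔xs a) ∘ proj₂ (P⇔Q a) ∘ proj₂ (Q⇔ys a))))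

count-positive : {P : A → Set} {c : ℕ} {a : A} → Count P c → P a → 0 < c
count-positive {c = zero} ([] , _ , P⇔[] , _) Pa with proj₁ (P⇔[] _) Pa
... | ()
count-positive {c = suc c} _ _ = s≤s z≤n

count-card : ∀ {N} {P : Fin N → Set} (P? : Decidable P) → Count P (card P?)
count-card {N} {P} P? = filter P? (allFin N) , filter⁺ P? (allFin⁺ N) , members , length-filter-tabulate id
  where
  members : ∀ a → Iff (P a) (a ∈ₗ filter P? (allFin N))
  members a = ∈-filter⁺ P? (∈-allFin a) , λ a∈ → proj₂ (∈-filter⁻ P? {xs = allFin N} a∈)
  length-filter-tabulate : ∀ {n} (f : Fin n → Fin N) →
    length (filter P? (List.tabulate f)) ≡ ∑ (λ i → onlyIf (does (P? (f i))) 1)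
  length-filter-tabulate {zero} f = refl
  length-filter-tabulate {suc n} f with does (P? (f zero))
  ... | true = cong suc (length-filter-tabulate (f ∘ suc))
  ... | false = length-filter-tabulate (f ∘ suc)

Count⇒≡card : ∀ {N} {P : Fin N → Set} (P? : Decidable P) {c : ℕ} → Count P c → c ≡ card P?
Count⇒≡card P? count = count-unique count (count-card P?) (λ _ → id , id)

Unique-map⁺ : (g : A → B) {xs : List A} → Unique xs →
  (∀ {a a′} → a ∈ₗ xs → a′ ∈ₗ xs → g a ≡ g a′ → a ≡ a′) → Unique (map g xs)
Unique-map⁺ g [] inj = []
Unique-map⁺ g (x∉xs ∷ xs!) inj =
  map⁺ (All.tabulate (λ y∈xs gx≡gy → All.lookup x∉xs y∈xs (inj (here refl) (there y∈xs) gx≡gy)))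
  ∷ Unique-map⁺ g xs! (λ a∈ a′∈ → inj (there a∈) (there a′∈))

count-product : {P : A → Set} {Q : B → Set} {R : C → Set} {p q : ℕ} (f : A → B → C) →
  Count P p → Count Q q →
  (∀ {a a′ b b′} → P a → P a′ → Q b → Q b′ → f a b ≡ f a′ b′ → a ≡ a′ × b ≡ b′) →
  (∀ c → Iff (R c) (∃₂ λ a b → P a × Q b × c ≡ f a b)) →
  Count R (p * q)
count-product {P = P} {Q} {R} f (xs , xs! , P⇔xs , refl) (ys , ys! , Q⇔ys , refl) f-inj R⇔ =
  cartesianProductWith f xs ys , unique xs! (λ a∈ → a∈) , members , length-product xs
  where
  P∈ : ∀ {a} → a ∈ₗ xs → P a
  P∈ = proj₂ (P⇔xs _)
  Q∈ : ∀ {b} → b ∈ₗ ys → Q b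
  Q∈ = proj₂ (Q⇔ys _)
  unique : ∀ {zs} → Unique zs → (∀ {a} → a ∈ₗ zs → a ∈ₗ xs) → Unique (cartesianProductWith f zs ys)
  unique [] _ = []
  unique {z ∷ zs} (z∉zs ∷ zs!) zs⊆xs = ++⁺
    (Unique-map⁺ (f z) ys! (λ b∈ b′∈ → proj₂ ∘ f-inj Pz Pz (Q∈ b∈) (Q∈ b′∈)))
    (unique zs! (zs⊆xs ∘ there))
    disjoint
    where
    Pz = P∈ (zs⊆xs (here refl))
    disjoint : ∀ {v} → ¬ (v ∈ₗ map (f z) ys × v ∈ₗ cartesianProductWith f zs ys)
    disjoint (v∈₁ , v∈₂) with ∈-map⁻ (f z) v∈₁ | ∈-cartesianProductWith⁻ f zs ys v∈₂
    ... | b , b∈ , refl | a , b′ , a∈ , b′∈ , eq =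
      All.lookup z∉zs a∈ (proj₁ (f-inj Pz (P∈ (zs⊆xs (there a∈))) (Q∈ b∈) (Q∈ b′∈) eq))
  members : ∀ c → Iff (R c) (c ∈ₗ cartesianProductWith f xs ys)
  members c = to , from
    where
    to : R c → c ∈ₗ cartesianProductWith f xs ys
    to Rc with proj₁ (R⇔ c) Rc
    ... | a , b , Pa , Qb , refl = ∈-cartesianProductWith⁺ f (proj₁ (P⇔xs a) Pa) (proj₁ (Q⇔ys b) Qb)
    from : c ∈ₗ cartesianProductWith f xs ys → R c
    from c∈ with ∈-cartesianProductWith⁻ f xs ys c∈
    ... | a , b , a∈ , b∈ , c≡ = proj₂ (R⇔ c) (a , b , P∈ a∈ , Q∈ b∈ , c≡)
  length-product : ∀ zs → length (cartesianProductWith f zs ys) ≡ length zs * length ys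
  length-product [] = refl
  length-product (z ∷ zs) = trans (length-++ (map (f z) ys)) (cong₂ _+_ (length-map (f z) ys) (length-product zs))

count-⋃ : {P : I → A → Set} (js : List (I × ℕ)) → Unique (map proj₁ js) →
  All (λ (j , c) → Count (P j) c) js →
  (∀ {j j′ a} → P j a → P j′ a → j ≡ j′) →
  Count (λ a → ∃ λ j → j ∈ₗ map proj₁ js × P j a) (sum (map proj₂ js))
count-⋃ [] [] [] _ = [] , [] , (λ a → (λ { (_ , () , _) }) , λ ()) , refl
count-⋃ {P = P} ((j , c) ∷ js) (j∉js ∷ js!) ((xs , xs! , P⇔xs , refl) ∷ counts) P-disjoint
  with count-⋃ js js! counts P-disjoint
... | ys , ys! , ⋃⇔ys , len = xs ++ ys , ++⁺ xs! ys! disjoint , members , trans (length-++ xs) (cong (length xs +_) len)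
  where
  disjoint : ∀ {v} → ¬ (v ∈ₗ xs × v ∈ₗ ys)
  disjoint {v} (v∈xs , v∈ys) with proj₂ (⋃⇔ys v) v∈ys
  ... | j′ , j′∈ , Pj′v = All.lookup j∉js j′∈ (P-disjoint (proj₂ (P⇔xs v) v∈xs) Pj′v)
  members : ∀ a → Iff (∃ λ j′ → j′ ∈ₗ map proj₁ ((j , c) ∷ js) × P j′ a) (a ∈ₗ xs ++ ys)
  members a = to , from ∘ ∈-++⁻ xs
    where
    to : (∃ λ j′ → j′ ∈ₗ map proj₁ ((j , c) ∷ js) × P j′ a) → a ∈ₗ xs ++ ys
    to (_ , here refl , Pja) = ∈-++⁺ˡ (proj₁ (P⇔xs a) Pja)
    to (j′ , there j′∈ , Pj′a) = ∈-++⁺ʳ xs (proj₁ (⋃⇔ys a) (j′ , j′∈ , Pj′a))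
    from : a ∈ₗ xs ⊎ a ∈ₗ ys → ∃ λ j′ → j′ ∈ₗ map proj₁ ((j , c) ∷ js) × P j′ a
    from (inj₁ a∈xs) = j , here refl , proj₂ (P⇔xs a) a∈xs
    from (inj₂ a∈ys) with proj₂ (⋃⇔ys a) a∈ys
    ... | j′ , j′∈ , Pj′a = j′ , there j′∈ , Pj′a

least : ∀ {n} {P : Fin n → Set} → Decidable P → ∀ a → P a → Σ (Fin n) λ u → P u × (∀ w → w <ᶠ u → ¬ P w)
least {suc n} P? a Pa with P? zero
... | yes P0 = zero , P0 , λ _ ()
... | no ¬P0 with a
...   | zero = ⊥-elim (¬P0 Pa)
...   | suc a′ with least (P? ∘ suc) a′ Pa
...     | u , Pu , u-least = suc u , Pu , below
  where
  below : ∀ w → w <ᶠ suc u → ¬ _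
  below zero _ = ¬P0
  below (suc w) (s≤s w<u) = u-least w w<u

least-unique : ∀ {n} {P : Fin n → Set} {a b : Fin n} →
  P a → (∀ w → w <ᶠ a → ¬ P w) → P b → (∀ w → w <ᶠ b → ¬ P w) → a ≡ b
least-unique {a = a} {b} Pa a-least Pb b-least with Fin.<-cmp a b
... | tri< a<b _ _ = ⊥-elim (b-least a a<b Pa)
... | tri≈ _ a≡b _ = a≡b
... | tri> _ _ b<a = ⊥-elim (a-least b b<a Pb)

-- Reachability

module Reachability {N M : ℕ} (ends : Ends N M) where

  src tgt : Fin M → Fin N
  src e = proj₁ (ends e)
  tgt e = proj₂ (ends e)

  Adj-src-tgt : ∀ e → Adj (ends e) (src e) (tgt e)
  Adj-src-tgt e = inj₁ (refl , refl)

  Adj-sym : ∀ {p : Fin N × Fin N} {u v} → Adj p u v → Adj p v u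
  Adj-sym (inj₁ (u≡ , v≡)) = inj₂ (v≡ , u≡)
  Adj-sym (inj₂ (u≡ , v≡)) = inj₁ (v≡ , u≡)

  private
    variable
      P Q S : Fin M → Set
      u v w x y : Fin N

  reach-trans : Reach ends P u v → Reach ends P v w → Reach ends P u w
  reach-trans here q = q
  reach-trans (step e Pe a p) q = step e Pe a (reach-trans p q)

  reach-edge : ∀ e → P e → Adj (ends e) u v → Reach ends P u v
  reach-edge e Pe a = step e Pe a here

  reach-sym : Reach ends P u v → Reach ends P v u
  reach-sym here = here
  reach-sym (step e Pe a p) = reach-trans (reach-sym p) (reach-edge e Pe (Adj-sym a))

  reach-via : (∀ e → P e → Reach ends Q (src e) (tgt e)) → Reach ends P u v → Reach ends Q u v
  reach-via h here = here
  reach-via h (step e Pe (inj₁ (refl , refl)) p) = reach-trans (h e Pe) (reach-via h p)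
  reach-via h (step e Pe (inj₂ (refl , refl)) p) = reach-trans (reach-sym (h e Pe)) (reach-via h p)

  reach-mono : (∀ e → P e → Q e) → Reach ends P u v → Reach ends Q u v
  reach-mono P⊆Q = reach-via (λ e Pe → reach-edge e (P⊆Q e Pe) (Adj-src-tgt e))

  data ViaLink (S : Fin M → Set) (x y u w : Fin N) : Set where
    avoiding : Reach ends S u w → ViaLink S x y u w
    forward  : Reach ends S u x → Reach ends S y w → ViaLink S x y u w
    backward : Reach ends S u y → Reach ends S x w → ViaLink S x y u w

  ViaLink-swap : ViaLink S x y u w → ViaLink S y x u w
  ViaLink-swap (avoiding p) = avoiding p
  ViaLink-swap (forward p q) = backward p q
  ViaLink-swap (backward p q) = forward p q

  reach-via-edge : ∀ e → (∀ f → Q f → S f ⊎ f ≡ e) → Reach ends Q u w → ViaLink S (src e) (tgt e) u w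
  reach-via-edge e Q⊆S+e here = avoiding here
  reach-via-edge {S = S} e Q⊆S+e (step f Qf a p) = extend f (Q⊆S+e f Qf) a (reach-via-edge e Q⊆S+e p)
    where
    extend : ∀ {u v w} f → S f ⊎ f ≡ e → Adj (ends f) u v →
      ViaLink S (src e) (tgt e) v w → ViaLink S (src e) (tgt e) u w
    extend f (inj₁ Sf) a (avoiding p) = avoiding (step f Sf a p)
    extend f (inj₁ Sf) a (forward p q) = forward (step f Sf a p) q
    extend f (inj₁ Sf) a (backward p q) = backward (step f Sf a p) q
    extend f (inj₂ refl) (inj₁ (refl , refl)) (avoiding p) = forward here p
    extend f (inj₂ refl) (inj₁ (refl , refl)) (forward p q) = avoiding (reach-trans (reach-sym p) q)
    extend f (inj₂ refl) (inj₁ (refl , refl)) (backward p q) = avoiding q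
    extend f (inj₂ refl) (inj₂ (refl , refl)) (avoiding p) = backward here p
    extend f (inj₂ refl) (inj₂ (refl , refl)) (forward p q) = avoiding q
    extend f (inj₂ refl) (inj₂ (refl , refl)) (backward p q) = avoiding (reach-trans (reach-sym p) q)

  ViaLink-redundant : Reach ends S x y → ViaLink S x y u w → Reach ends S u w
  ViaLink-redundant x~y (avoiding p) = p
  ViaLink-redundant x~y (forward p q) = reach-trans p (reach-trans x~y q)
  ViaLink-redundant x~y (backward p q) = reach-trans p (reach-trans (reach-sym x~y) q)

  module Decide (P : Fin M → Set) (P? : Decidable P) where

    Among : List (Fin M) → Fin M → Set
    Among es f = P f × f ∈ₗ es

    -- union-find: after processing es, two vertices share a label iff the P-edges of es connect them
    merge : (Fin N → Fin N) → Fin M → Fin N → Fin N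
    merge c e v = if does (c v ≟ᶠ c (tgt e)) then c (src e) else c v

    label : List (Fin M) → Fin N → Fin N
    label [] = id
    label (e ∷ es) = if does (P? e) then merge (label es) e else label es

    merge-src : ∀ c e v → c v ≡ c (src e) → merge c e v ≡ c (src e)
    merge-src c e v cv≡ with c v ≟ᶠ c (tgt e)
    ... | yes _ = refl
    ... | no _ = cv≡

    merge-tgt : ∀ c e v → c v ≡ c (tgt e) → merge c e v ≡ c (src e)
    merge-tgt c e v cv≡ with c v ≟ᶠ c (tgt e)
    ... | yes _ = refl
    ... | no cv≢ = ⊥-elim (cv≢ cv≡)

    Correct : List (Fin M) → Set
    Correct es = ∀ u v → Iff (label es u ≡ label es v) (Reach ends (Among es) u v)

    label-[] : Correct []
    label-[] u v = (λ { refl → here }) , stuck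
      where
      stuck : Reach ends (Among []) u v → u ≡ v
      stuck here = refl
      stuck (step _ (_ , ()) _ _)

    label-skip : ∀ e es → ¬ P e → Correct es → Correct (e ∷ es)
    label-skip e es ¬Pe ih u v with P? e
    ... | yes Pe = ⊥-elim (¬Pe Pe)
    ... | no _ = reach-mono later ∘ proj₁ (ih u v) , proj₂ (ih u v) ∘ reach-mono earlier
      where
      later : ∀ f → Among es f → Among (e ∷ es) f
      later f (Pf , f∈) = Pf , there f∈
      earlier : ∀ f → Among (e ∷ es) f → Among es f
      earlier f (Pf , here refl) = ⊥-elim (¬Pe Pf)
      earlier f (Pf , there f∈) = Pf , f∈

    label-merge : ∀ e es → P e → Correct es → Correct (e ∷ es)
    label-merge e es Pe ih u v with P? e
    ... | no ¬Pe = ⊥-elim (¬Pe Pe)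
    ... | yes _ = sound , complete
      where
      c = label es
      later : ∀ f → Among es f → Among (e ∷ es) f
      later f (Pf , f∈) = Pf , there f∈
      old-or-e : ∀ f → Among (e ∷ es) f → Among es f ⊎ f ≡ e
      old-or-e f (_ , here f≡e) = inj₂ f≡e
      old-or-e f (Pf , there f∈) = inj₁ (Pf , f∈)
      old : ∀ {a b} → c a ≡ c b → Reach ends (Among (e ∷ es)) a b
      old = reach-mono later ∘ proj₁ (ih _ _)
      e-edge : Reach ends (Among (e ∷ es)) (src e) (tgt e)
      e-edge = reach-edge e (Pe , here refl) (Adj-src-tgt e)
      sound : merge c e u ≡ merge c e v → Reach ends (Among (e ∷ es)) u v
      sound eq with c u ≟ᶠ c (tgt e) | c v ≟ᶠ c (tgt e)
      ... | yes u≡ | yes v≡ = old (trans u≡ (sym v≡))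
      ... | yes u≡ | no _ = reach-trans (old u≡) (reach-trans (reach-sym e-edge) (old eq))
      ... | no _ | yes v≡ = reach-trans (old eq) (reach-trans e-edge (old (sym v≡)))
      ... | no _ | no _ = old eq
      complete : Reach ends (Among (e ∷ es)) u v → merge c e u ≡ merge c e v
      complete p with reach-via-edge e old-or-e p
      ... | avoiding q = cong (λ a → if does (a ≟ᶠ c (tgt e)) then c (src e) else a) (proj₂ (ih u v) q)
      ... | forward q r = trans (merge-src c e u (proj₂ (ih _ _) q)) (sym (merge-tgt c e v (sym (proj₂ (ih _ _) r))))
      ... | backward q r = trans (merge-tgt c e u (proj₂ (ih _ _) q)) (sym (merge-src c e v (sym (proj₂ (ih _ _) r))))

    label-correct : ∀ es → Correct es
    label-correct [] = label-[]
    label-correct (e ∷ es) = by-cases (P? e)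
      where
      by-cases : Dec (P e) → Correct (e ∷ es)
      by-cases (yes Pe) = label-merge e es Pe (label-correct es)
      by-cases (no ¬Pe) = label-skip e es ¬Pe (label-correct es)

    reach? : ∀ u v → Dec (Reach ends P u v)
    reach? u v with label (allFin M) u ≟ᶠ label (allFin M) v
    ... | yes eq = yes (reach-mono (λ _ → proj₁) (proj₁ (label-correct (allFin M) u v) eq))
    ... | no neq = no (neq ∘ proj₂ (label-correct (allFin M) u v) ∘ reach-mono (λ f Pf → Pf , ∈-allFin f))

  Within : (Fin N → Set) → (Fin M → Set) → Set
  Within V S = ∀ e → S e → V (src e) × V (tgt e)

  reach-closed : {V : Fin N → Set} → Within V S → V u → Reach ends S u w → V w
  reach-closed S⊆V Vu here = Vu
  reach-closed S⊆V Vu (step e Se (inj₁ (refl , refl)) p) = reach-closed S⊆V (proj₂ (S⊆V e Se)) p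
  reach-closed S⊆V Vu (step e Se (inj₂ (refl , refl)) p) = reach-closed S⊆V (proj₁ (S⊆V e Se)) p

  reach-outside : {V : Fin N → Set} → Within V S → ¬ V u → Reach ends S u w → u ≡ w
  reach-outside S⊆V ¬Vu here = refl
  reach-outside S⊆V ¬Vu (step e Se (inj₁ (refl , refl)) p) = ⊥-elim (¬Vu (proj₁ (S⊆V e Se)))
  reach-outside S⊆V ¬Vu (step e Se (inj₂ (refl , refl)) p) = ⊥-elim (¬Vu (proj₂ (S⊆V e Se)))

  Forest : (Fin M → Set) → Set
  Forest F = ∀ e → F e → ¬ Reach ends (λ f → F f × f ≢ e) (src e) (tgt e)

  forest-insert : ∀ e → Forest S → ¬ Reach ends S (src e) (tgt e) →
    (∀ f → Q f → S f ⊎ f ≡ e) → (∀ f → S f → Q f) → Forest Q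
  forest-insert {S = S} {Q = Q} e S-forest e-new Q⊆S+e S⊆Q g Qg p with Q⊆S+e g Qg
  ... | inj₂ refl = e-new (reach-mono old p)
    where
    old : ∀ f → Q f × f ≢ g → S f
    old f (Qf , f≢g) with Q⊆S+e f Qf
    ... | inj₁ Sf = Sf
    ... | inj₂ f≡g = ⊥-elim (f≢g f≡g)
  ... | inj₁ Sg with reach-via-edge e Q-g⊆S-g+e p
    where
    Q-g⊆S-g+e : ∀ f → Q f × f ≢ g → (S f × f ≢ g) ⊎ f ≡ e
    Q-g⊆S-g+e f (Qf , f≢g) = map₁ (_, f≢g) (Q⊆S+e f Qf)
  ...   | avoiding q = S-forest g Sg q
  ...   | forward q r = e-new (reach-trans (reach-sym (reach-mono (λ _ → proj₁) q))
                          (reach-trans (reach-edge g Sg (Adj-src-tgt g)) (reach-sym (reach-mono (λ _ → proj₁) r))))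
  ...   | backward q r = e-new (reach-trans (reach-mono (λ _ → proj₁) r)
                          (reach-trans (reach-edge g Sg (Adj-sym (Adj-src-tgt g))) (reach-mono (λ _ → proj₁) q)))

-- Components and forests

module Components {N M : ℕ} (ends : Ends N M) (P : Fin M → Set) (P? : Decidable P) where
  open Reachability ends
  open Decide P P? using (reach?)

  private
    variable
      u v : Fin N

  leaderΣ : ∀ v → Σ (Fin N) λ ℓ → Reach ends P v ℓ × (∀ w → w <ᶠ ℓ → ¬ Reach ends P v w)
  leaderΣ v = least (reach? v) v here

  leader : Fin N → Fin N
  leader v = proj₁ (leaderΣ v)

  leader-reach : ∀ v → Reach ends P v (leader v)
  leader-reach v = proj₁ (proj₂ (leaderΣ v))

  leader-least : ∀ v w → w <ᶠ leader v → ¬ Reach ends P v w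
  leader-least v = proj₂ (proj₂ (leaderΣ v))

  leader-cong : Reach ends P u v → leader u ≡ leader v
  leader-cong {u} {v} p = least-unique (reach-trans (reach-sym p) (leader-reach u))
    (λ w w< q → leader-least u w w< (reach-trans p q)) (leader-reach v) (leader-least v)

  leader-reach⁻ : leader u ≡ leader v → Reach ends P u v
  leader-reach⁻ {u} {v} eq = reach-trans (subst (Reach ends P u) eq (leader-reach u)) (reach-sym (leader-reach v))

  leader-≤ : ∀ v → leader v ≤ᶠ v
  leader-≤ v = ≮⇒≥ (λ v<ℓ → leader-least v v v<ℓ here)

  leader-idem : ∀ v → leader (leader v) ≡ leader v
  leader-idem v = leader-cong (reach-sym (leader-reach v))

  IsLeader : Fin N → Set
  IsLeader ℓ = leader ℓ ≡ ℓ

  isLeader? : Decidable IsLeader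
  isLeader? ℓ = leader ℓ ≟ᶠ ℓ

  IsLeader⇒least : ∀ {ℓ} → IsLeader ℓ → ∀ w → w <ᶠ ℓ → ¬ Reach ends P ℓ w
  IsLeader⇒least {ℓ} isL w w<ℓ = leader-least ℓ w (subst (w <ᶠ_) (sym isL) w<ℓ)

  least⇒IsLeader : ∀ {ℓ} → (∀ w → w <ᶠ ℓ → ¬ Reach ends P ℓ w) → IsLeader ℓ
  least⇒IsLeader {ℓ} ℓ-least = least-unique (leader-reach ℓ) (leader-least ℓ) here ℓ-least

  #components : ℕ
  #components = card isLeader?

module CompareComponents {N M : ℕ} (ends : Ends N M)
  (S : Fin M → Set) (S? : Decidable S) (Q : Fin M → Set) (Q? : Decidable Q) where
  open Reachability ends
  module CS = Components ends S S?
  module CQ = Components ends Q Q?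

  components-cong : (∀ {u v} → Reach ends S u v → Reach ends Q u v) → (∀ {u v} → Reach ends Q u v → Reach ends S u v) →
    CS.#components ≡ CQ.#components
  components-cong S⇒Q Q⇒S = card-cong CS.isLeader? CQ.isLeader? λ ℓ →
    (λ isL → trans (sym (same-leader ℓ)) isL) , (λ isL → trans (same-leader ℓ) isL)
    where
    same-leader : ∀ v → CS.leader v ≡ CQ.leader v
    same-leader v = least-unique (S⇒Q (CS.leader-reach v)) (λ w w< → CS.leader-least v w w< ∘ Q⇒S)
      (CQ.leader-reach v) (CQ.leader-least v)

  module _ (S⇒Q : ∀ {u v} → Reach ends S u v → Reach ends Q u v) where

    -- the component of y is absorbed into that of x; every other S-leader stays a Q-leader
    components-merge-ordered : ∀ x y → (∀ {u w} → Reach ends Q u w → ViaLink S x y u w) → Reach ends Q x y →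
      CS.leader x <ᶠ CS.leader y → CS.#components ≡ CQ.#components + 1
    components-merge-ordered x y Q⇒S+xy x~y lx<ly = sym (card-insert CQ.isLeader? CS.isLeader? b same b-not-Q b-S)
      where
      a = CS.leader x
      b = CS.leader y
      b-S : CS.IsLeader b
      b-S = CS.leader-idem y
      b-not-Q : ¬ CQ.IsLeader b
      b-not-Q isL = CQ.IsLeader⇒least isL a lx<ly
        (reach-trans (S⇒Q (reach-sym (CS.leader-reach y))) (reach-trans (reach-sym x~y) (S⇒Q (CS.leader-reach x))))
      same : ∀ ℓ → ℓ ≢ b → Iff (CQ.IsLeader ℓ) (CS.IsLeader ℓ)
      same ℓ ℓ≢b = (λ isL → CS.least⇒IsLeader λ w w<ℓ → CQ.IsLeader⇒least isL w w<ℓ ∘ S⇒Q) , to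
        where
        to : CS.IsLeader ℓ → CQ.IsLeader ℓ
        to isL = CQ.least⇒IsLeader below
          where
          below : ∀ w → w <ᶠ ℓ → ¬ Reach ends Q ℓ w
          below w w<ℓ p with Q⇒S+xy p
          ... | avoiding q = CS.IsLeader⇒least isL w w<ℓ q
          ... | forward q r = <-irrefl refl (≤-<-trans b≤w (<-trans w<ℓ (subst (_<ᶠ b) (sym ℓ≡a) lx<ly)))
            where
            ℓ≡a : ℓ ≡ a
            ℓ≡a = trans (sym isL) (CS.leader-cong q)
            b≤w : b ≤ᶠ w
            b≤w = subst (_≤ᶠ w) (CS.leader-cong (reach-sym r)) (CS.leader-≤ w)
          ... | backward q r = ℓ≢b (trans (sym isL) (CS.leader-cong q))

    components-merge : ∀ x y → (∀ {u w} → Reach ends Q u w → ViaLink S x y u w) → Reach ends Q x y →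
      ¬ Reach ends S x y → CS.#components ≡ CQ.#components + 1
    components-merge x y Q⇒S+xy x~y x≁y with Fin.<-cmp (CS.leader x) (CS.leader y)
    ... | tri< lx<ly _ _ = components-merge-ordered x y Q⇒S+xy x~y lx<ly
    ... | tri≈ _ lx≡ly _ = ⊥-elim (x≁y (CS.leader-reach⁻ lx≡ly))
    ... | tri> _ _ ly<lx = components-merge-ordered y x (ViaLink-swap ∘ Q⇒S+xy) (reach-sym x~y) ly<lx

module EdgeCount {N M : ℕ} (ends : Ends N M) (F : Fin M → Set) (F? : Decidable F) where
  open Reachability ends

  Upto : List (Fin M) → Fin M → Set
  Upto es f = F f × f ∈ₗ es

  Upto? : ∀ es → Decidable (Upto es)
  Upto? es f = F? f ×-dec any? (f ≟ᶠ_) es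

  #comp : List (Fin M) → ℕ
  #comp es = Components.#components ends (Upto es) (Upto? es)

  #edges : List (Fin M) → ℕ
  #edges es = card (Upto? es)

  count-[] : #comp [] + #edges [] ≡ N
  count-[] = begin
    #comp [] + #edges [] ≡⟨ cong₂ _+_ (trans (card-cong isLeader? (λ _ → yes tt) λ _ → (λ _ → tt) , λ _ → all-leaders) (card-all N))
                                      (card-∅ (Upto? []) λ _ ()) ⟩
    N + 0                ≡⟨ +-identityʳ N ⟩
    N                    ∎
    where
    open ≡-Reasoning
    open Components ends (Upto []) (Upto? []) using (IsLeader; isLeader?; least⇒IsLeader)
    alone : ∀ {u v} → Reach ends (Upto []) u v → u ≡ v
    alone here = refl
    alone (step _ (_ , ()) _ _)
    all-leaders : ∀ {ℓ} → IsLeader ℓ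
    all-leaders = least⇒IsLeader λ w w<ℓ p → <-irrefl (cong toℕ (sym (alone p))) w<ℓ

  module Step (e : Fin M) (es : List (Fin M)) (e∉es : All (e ≢_) es) where
    open CompareComponents ends (Upto es) (Upto? es) (Upto (e ∷ es)) (Upto? (e ∷ es))

    earlier : ∀ f → Upto es f → Upto (e ∷ es) f
    earlier f (Ff , f∈) = Ff , there f∈

    earlier-or-e : ∀ f → Upto (e ∷ es) f → Upto es f ⊎ f ≡ e
    earlier-or-e f (_ , here f≡e) = inj₂ f≡e
    earlier-or-e f (Ff , there f∈) = inj₁ (Ff , f∈)

    skip : ¬ F e → #comp es + #edges es ≡ #comp (e ∷ es) + #edges (e ∷ es)
    skip ¬Fe = cong₂ _+_ (components-cong (reach-mono earlier) (reach-mono drop)) (card-cong (Upto? es) (Upto? (e ∷ es)) λ f → earlier f , drop f)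
      where
      drop : ∀ f → Upto (e ∷ es) f → Upto es f
      drop f (Ff , here refl) = ⊥-elim (¬Fe Ff)
      drop f (Ff , there f∈) = Ff , f∈

    add : F e → #edges es + 1 ≡ #edges (e ∷ es)
    add Fe = card-insert (Upto? es) (Upto? (e ∷ es)) e same (λ (_ , e∈) → All.lookup e∉es e∈ refl) (Fe , here refl)
      where
      same : ∀ f → f ≢ e → Iff (Upto es f) (Upto (e ∷ es) f)
      same f f≢e = earlier f , λ where
        (_ , here f≡e) → ⊥-elim (f≢e f≡e)
        (Ff , there f∈) → Ff , f∈

    merge : F e → ¬ Reach ends (Upto es) (src e) (tgt e) → #comp es + #edges es ≡ #comp (e ∷ es) + #edges (e ∷ es)
    merge Fe new = begin
      #comp es + #edges es               ≡⟨ cong (_+ #edges es) (components-merge (reach-mono earlier) (src e) (tgt e)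
                                              (reach-via-edge e earlier-or-e) (reach-edge e (Fe , here refl) (Adj-src-tgt e)) new) ⟩
      #comp (e ∷ es) + 1 + #edges es     ≡⟨ +-assoc (#comp (e ∷ es)) 1 _ ⟩
      #comp (e ∷ es) + (1 + #edges es)   ≡⟨ cong (#comp (e ∷ es) +_) (trans (+-comm 1 _) (add Fe)) ⟩
      #comp (e ∷ es) + #edges (e ∷ es)   ∎
      where open ≡-Reasoning

    redundant : F e → Reach ends (Upto es) (src e) (tgt e) → #comp es + #edges es ≤ #comp (e ∷ es) + #edges (e ∷ es)
    redundant Fe old = +-mono-≤ (≤-reflexive (components-cong (reach-mono earlier) (ViaLink-redundant old ∘ reach-via-edge e earlier-or-e)))
      (≤-trans (m≤m+n _ 1) (≤-reflexive (add Fe)))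

  count-≥ : ∀ es → Unique es → N ≤ #comp es + #edges es
  count-≥ [] [] = ≤-reflexive (sym count-[])
  count-≥ (e ∷ es) (e∉es ∷ es!) with F? e
  ... | no ¬Fe = ≤-trans (count-≥ es es!) (≤-reflexive (Step.skip e es e∉es ¬Fe))
  ... | yes Fe with Decide.reach? (Upto es) (Upto? es) (src e) (tgt e)
  ...   | yes old = ≤-trans (count-≥ es es!) (Step.redundant e es e∉es Fe old)
  ...   | no new = ≤-trans (count-≥ es es!) (≤-reflexive (Step.merge e es e∉es Fe new))

  forest-count-upto : Forest F → ∀ es → Unique es → #comp es + #edges es ≡ N
  forest-count-upto F-forest [] [] = count-[]
  forest-count-upto F-forest (e ∷ es) (e∉es ∷ es!) with F? e
  ... | no ¬Fe = trans (sym (Step.skip e es e∉es ¬Fe)) (forest-count-upto F-forest es es!)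
  ... | yes Fe = trans (sym (Step.merge e es e∉es Fe new)) (forest-count-upto F-forest es es!)
    where
    new : ¬ Reach ends (Upto es) (src e) (tgt e)
    new = F-forest e Fe ∘ reach-mono λ f (Ff , f∈) → Ff , λ f≡e → All.lookup e∉es f∈ (sym f≡e)

  count-all : #comp (allFin M) + #edges (allFin M) ≡ Components.#components ends F F? + card F?
  count-all = cong₂ _+_
    (CompareComponents.components-cong ends (Upto (allFin M)) (Upto? (allFin M)) F F?
      (reach-mono λ _ → proj₁) (reach-mono λ f Ff → Ff , ∈-allFin f))
    (card-cong (Upto? (allFin M)) F? λ f → proj₁ , λ Ff → Ff , ∈-allFin f)

  forest-count : Forest F → Components.#components ends F F? + card F? ≡ N
  forest-count F-forest = trans (sym count-all) (forest-count-upto F-forest (allFin M) (allFin⁺ M))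

  components-+-edges-≥ : N ≤ Components.#components ends F F? + card F?
  components-+-edges-≥ = ≤-trans (count-≥ (allFin M) (allFin⁺ M)) (≤-reflexive count-all)

-- Spanning trees

_∖_ : ∀ {M} → Subset M → Fin M → Fin M → Set
(T ∖ e) f = f ∈ T × f ≢ e

_∖?_ : ∀ {M} (T : Subset M) e → Decidable (T ∖ e)
(T ∖? e) f = (f ∈? T) ×-dec ¬? (f ≟ᶠ e)

card-∖ : ∀ {M} (T : Subset M) e → e ∈ T → card (T ∖? e) + 1 ≡ card (_∈? T)
card-∖ T e e∈T = card-insert (T ∖? e) (_∈? T) e (λ f f≢e → proj₁ , (_, f≢e)) (λ (_ , e≢e) → e≢e refl) e∈T

module SpanningTrees {N M : ℕ} (ends : Ends N M) where
  open Reachability ends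

  private
    variable
      V : Fin N → Set
      E : Fin M → Set
      T : Subset M

  spans-without : ∀ {e} → Reach ends (T ∖ e) (src e) (tgt e) → Spans ends V (_∈ T) → Spans ends V (T ∖ e)
  spans-without {T = T} {e = e} bypass T-spans u v Vu Vv = reach-via shortcut (T-spans u v Vu Vv)
    where
    shortcut : ∀ f → f ∈ T → Reach ends (T ∖ e) (src f) (tgt f)
    shortcut f f∈T with f ≟ᶠ e
    ... | yes refl = bypass
    ... | no f≢e = reach-edge f (f∈T , f≢e) (Adj-src-tgt f)

  minimal⇒forest : Spans ends V (_∈ T) → (∀ e → e ∈ T → ¬ Spans ends V (T ∖ e)) → Forest (_∈ T)
  minimal⇒forest T-spans T-minimal e e∈T bypass = T-minimal e e∈T (spans-without bypass T-spans)

  forest⇒minimal : Within V (_∈ T) → Forest (_∈ T) → ∀ e → e ∈ T → ¬ Spans ends V (T ∖ e)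
  forest⇒minimal T⊆V T-forest e e∈T T∖e-spans =
    T-forest e e∈T (T∖e-spans (src e) (tgt e) (proj₁ (T⊆V e e∈T)) (proj₂ (T⊆V e e∈T)))

  -- V forms a single component (led by its least vertex m); every vertex outside V is alone
  spanning-components : (V? : Decidable V) {S : Fin M → Set} (S? : Decidable S) → Spans ends V S → Within V S →
    ∀ {v₀} → V v₀ → Components.#components ends S S? + card V? ≡ N + 1
  spanning-components {V} V? S? S-spans S⊆V {v₀} Vv₀ = begin
    #components + card V?                                               ≡⟨ ∑-distrib-+ (λ ℓ → onlyIf (does (isLeader? ℓ)) 1) (λ ℓ → onlyIf (does (V? ℓ)) 1) ⟨
    ∑ (λ ℓ → onlyIf (does (isLeader? ℓ)) 1 + onlyIf (does (V? ℓ)) 1) ≡⟨ sum-cong-≗ pointwise ⟩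
    ∑ (λ ℓ → 1 + onlyIf (does (ℓ ≟ᶠ m)) 1)                            ≡⟨ ∑-distrib-+ (λ _ → 1) (λ ℓ → onlyIf (does (ℓ ≟ᶠ m)) 1) ⟩
    ∑ {N} (λ _ → 1) + ∑ (λ ℓ → onlyIf (does (ℓ ≟ᶠ m)) 1)                  ≡⟨ cong₂ _+_ (∑-one N) (∑-indicator m 1) ⟩
    N + 1                                                               ∎
    where
    open ≡-Reasoning
    open Components ends _ S?
    m = proj₁ (least V? v₀ Vv₀)
    Vm = proj₁ (proj₂ (least V? v₀ Vv₀))
    m-least = proj₂ (proj₂ (least V? v₀ Vv₀))
    leader-inside : ∀ {ℓ} → V ℓ → leader ℓ ≡ m
    leader-inside {ℓ} Vℓ = least-unique (leader-reach ℓ) (leader-least ℓ)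
      (S-spans ℓ m Vℓ Vm) (λ w w<m p → m-least w w<m (reach-closed S⊆V Vℓ p))
    leader-outside : ∀ {ℓ} → ¬ V ℓ → IsLeader ℓ
    leader-outside ¬Vℓ = least⇒IsLeader λ w w<ℓ p → <-irrefl (cong toℕ (sym (reach-outside S⊆V ¬Vℓ p))) w<ℓ
    pointwise : ∀ ℓ → onlyIf (does (isLeader? ℓ)) 1 + onlyIf (does (V? ℓ)) 1 ≡ 1 + onlyIf (does (ℓ ≟ᶠ m)) 1
    pointwise ℓ with V? ℓ
    ... | yes Vℓ = trans (cong (λ b → onlyIf b 1 + 1) (does-iff leader⇔m (isLeader? ℓ) (ℓ ≟ᶠ m))) (+-comm _ 1)
      where
      leader⇔m : Iff (IsLeader ℓ) (ℓ ≡ m)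
      leader⇔m = (λ isL → trans (sym isL) (leader-inside Vℓ)) , (λ ℓ≡m → trans (leader-inside Vℓ) (sym ℓ≡m))
    ... | no ¬Vℓ rewrite dec-true (isLeader? ℓ) (leader-outside ¬Vℓ)
                       | dec-false (ℓ ≟ᶠ m) (λ ℓ≡m → ¬Vℓ (subst V (sym ℓ≡m) Vm)) = refl

  tree-size : (V? : Decidable V) → IsSpanningTree ends V E T → Within V E → ∀ {v₀} → V v₀ → card (_∈? T) + 1 ≡ card V?
  tree-size {T = T} V? (T⊆E , T-spans , T-minimal) E⊆V Vv₀ = +-cancelˡ-≡ c _ _ (begin
    c + (card (_∈? T) + 1) ≡⟨ +-assoc c _ 1 ⟨
    c + card (_∈? T) + 1   ≡⟨ cong (_+ 1) (EdgeCount.forest-count ends (_∈ T) (_∈? T) (minimal⇒forest T-spans T-minimal)) ⟩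
    N + 1                  ≡⟨ spanning-components V? (_∈? T) T-spans (λ e e∈T → E⊆V e (T⊆E e e∈T)) Vv₀ ⟨
    c + card V?            ∎)
    where
    open ≡-Reasoning
    c = Components.#components ends (_∈ T) (_∈? T)

  -- a connected spanning edge set needs N − 1 edges, so none of the N − 1 edges of T can be spared
  size⇒minimal : Spans ends All⊤ (_∈ T) → card (_∈? T) + 1 ≡ N → ∀ e → e ∈ T → ¬ Spans ends All⊤ (T ∖ e)
  size⇒minimal {T = T} T-spans |T|+1≡N e e∈T T∖e-spans = <-irrefl refl (begin-strict
    s + 2     ≡⟨ trans (sym (+-assoc s 1 1)) (trans (cong (_+ 1) (card-∖ T e e∈T)) |T|+1≡N) ⟩
    N         ≤⟨ EdgeCount.components-+-edges-≥ ends (T ∖ e) (T ∖? e) ⟩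
    c + s     ≡⟨ cong (_+ s) one-component ⟩
    1 + s     ≡⟨ +-comm 1 s ⟩
    s + 1     <⟨ +-monoʳ-< s (s≤s (s≤s z≤n)) ⟩
    s + 2     ∎)
    where
    open ≤-Reasoning
    s = card (T ∖? e)
    c = Components.#components ends (T ∖ e) (T ∖? e)
    one-component : c ≡ 1
    one-component = +-cancelʳ-≡ N c 1 (begin-equality
      c + N              ≡⟨ cong (c +_) (card-all N) ⟨
      c + card {N} {All⊤} (λ _ → yes tt) ≡⟨ spanning-components (λ _ → yes tt) (T ∖? e) T∖e-spans (λ _ _ → tt , tt) {src e} tt ⟩
      N + 1              ≡⟨ +-comm N 1 ⟩
      1 + N              ∎)

  module Kruskal (A : Fin M → Set) (A? : Decidable A) where

    data Inserted (e : Fin M) (T T′ : Subset M) : Set where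
      added : A e → ¬ Reach ends (_∈ T) (src e) (tgt e) →
        (∀ f → f ∈ T′ → f ∈ T ⊎ f ≡ e) → (∀ f → f ∈ T → f ∈ T′) → e ∈ T′ → Inserted e T T′
      skipped : T′ ≡ T → (A e → Reach ends (_∈ T) (src e) (tgt e)) → Inserted e T T′

    insert : Fin M → Subset M → Subset M
    insert e T with A? e | Decide.reach? (_∈ T) (_∈? T) (src e) (tgt e)
    ... | yes _ | no _ = ⁅ e ⁆ ∪ T
    ... | _ | _ = T

    insert-view : ∀ e T → Inserted e T (insert e T)
    insert-view e T with A? e | Decide.reach? (_∈ T) (_∈? T) (src e) (tgt e)
    ... | yes Ae | no new = added Ae new old-or-e (λ f f∈T → x∈p∪q⁺ (inj₂ f∈T)) (x∈p∪q⁺ (inj₁ (x∈⁅x⁆ e)))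
      where
      old-or-e : ∀ f → f ∈ ⁅ e ⁆ ∪ T → f ∈ T ⊎ f ≡ e
      old-or-e f f∈ with x∈p∪q⁻ ⁅ e ⁆ T f∈
      ... | inj₁ f∈e = inj₂ (x∈⁅y⁆⇒x≡y e f∈e)
      ... | inj₂ f∈T = inj₁ f∈T
    ... | yes _ | yes old = skipped refl (λ _ → old)
    ... | no ¬Ae | _ = skipped refl (⊥-elim ∘ ¬Ae)

    grow : List (Fin M) → Subset M
    grow = List.foldr insert ⊥

    record Invariant (es : List (Fin M)) (T : Subset M) : Set where
      field
        within-A : ∀ f → f ∈ T → A f
        forest : Forest (_∈ T)
        connects : ∀ f → f ∈ₗ es → A f → Reach ends (_∈ T) (src f) (tgt f)

    invariant : ∀ es → Invariant es (grow es)
    invariant [] = record { within-A = λ _ f∈ → ⊥-elim (∉⊥ f∈) ; forest = λ _ e∈ → ⊥-elim (∉⊥ e∈) ; connects = λ _ () }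
    invariant (e ∷ es) = extend (insert-view e (grow es))
      where
      open Invariant (invariant es)
      extend : Inserted e (grow es) (insert e (grow es)) → Invariant (e ∷ es) (insert e (grow es))
      extend (added Ae new T′⊆T+e T⊆T′ e∈T′) = record
        { within-A = λ f f∈ → [ within-A f , (λ f≡e → subst A (sym f≡e) Ae) ]′ (T′⊆T+e f f∈)
        ; forest = forest-insert e forest new T′⊆T+e T⊆T′
        ; connects = λ where
            _ (here refl) _ → reach-edge e e∈T′ (Adj-src-tgt e)
            f (there f∈) Af → reach-mono T⊆T′ (connects f f∈ Af)
        }
      extend (skipped T′≡T old) = subst (Invariant (e ∷ es)) (sym T′≡T) record
        { within-A = within-A
        ; forest = forest
        ; connects = λ where
            _ (here refl) Ae → old Ae
            f (there f∈) Af → connects f f∈ Af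
        }

    spanning-tree : Within V A → Spans ends V A → IsSpanningTree ends V A (grow (allFin M))
    spanning-tree {V} A⊆V A-spans = within-A , spans , forest⇒minimal (λ e e∈T → A⊆V e (within-A e e∈T)) forest
      where
      open Invariant (invariant (allFin M))
      spans : Spans ends V (_∈ grow (allFin M))
      spans u v Vu Vv = reach-via (λ f Af → connects f (∈-allFin f) Af) (A-spans u v Vu Vv)

  spanning-tree-exists : Decidable E → Within V E → Spans ends V E → ∃ (IsSpanningTree ends V E)
  spanning-tree-exists E? E⊆V E-spans = _ , Kruskal.spanning-tree _ E? E⊆V E-spans

module Multiples (tot k : ℕ) where

  IsMultiple : ℕ → Set
  IsMultiple p = ∃ λ t → p * k ≡ t * tot

  multiple-0 : IsMultiple 0
  multiple-0 = 0 , refl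

  multiple-+ : ∀ {a b} → IsMultiple a → IsMultiple b → IsMultiple (a + b)
  multiple-+ {a} {b} (s , ak≡) (t , bk≡) =
    s + t , trans (*-distribʳ-+ k a b) (trans (cong₂ _+_ ak≡ bk≡) (sym (*-distribʳ-+ tot s t)))

  multiple-∸ : ∀ {a b} → IsMultiple (a + b) → IsMultiple b → IsMultiple a
  multiple-∸ {a} {b} (t , abk≡) (s , bk≡) = t ∸ s , (begin
    a * k                 ≡⟨ m+n∸n≡m (a * k) (b * k) ⟨
    a * k + b * k ∸ b * k ≡⟨ cong₂ _∸_ (trans (sym (*-distribʳ-+ k a b)) abk≡) bk≡ ⟩
    t * tot ∸ s * tot     ≡⟨ *-distribʳ-∸ tot t s ⟨
    (t ∸ s) * tot         ∎)
    where open ≡-Reasoning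

  multiple-∑ : ∀ {n} (g : Fin n → ℕ) → (∀ i → IsMultiple (g i)) → IsMultiple (∑ g)
  multiple-∑ {zero} g _ = multiple-0
  multiple-∑ {suc n} g mult = multiple-+ {g zero} {∑ (g ∘ suc)} (mult zero) (multiple-∑ (g ∘ suc) (mult ∘ suc))

  multiple-∑-remaining : ∀ {n} (g : Fin n → ℕ) j → IsMultiple (∑ g) → (∀ i → i ≢ j → IsMultiple (g i)) → IsMultiple (g j)
  multiple-∑-remaining g j mult-∑ mult-others = multiple-∸ {g j} {∑ g′} (subst IsMultiple ∑g≡ mult-∑) (multiple-∑ g′ mult-g′)
    where
    g′ : Fin _ → ℕ
    g′ i = onlyIf (does (¬? (i ≟ᶠ j))) (g i)
    ∑g≡ : ∑ g ≡ g j + ∑ g′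
    ∑g≡ = begin
      ∑ g          ≡⟨ +-identityʳ (∑ g) ⟨
      ∑ g + 0      ≡⟨ cong (λ b → ∑ g + onlyIf b (g j)) (dec-false (¬? (j ≟ᶠ j)) λ j≢j → j≢j refl) ⟨
      ∑ g + g′ j   ≡⟨ ∑-update g g′ j (λ i i≢j → cong (λ b → onlyIf b (g i)) (sym (dec-true (¬? (i ≟ᶠ j)) i≢j))) ⟩
      ∑ g′ + g j   ≡⟨ +-comm (∑ g′) (g j) ⟩
      g j + ∑ g′   ∎
      where open ≡-Reasoning
    mult-g′ : ∀ i → IsMultiple (g′ i)
    mult-g′ i with i ≟ᶠ j
    ... | yes _ = multiple-0
    ... | no i≢j = mult-others i i≢j

  multiple-not-small : ∀ {r} → IsMultiple r → 0 < r * k → r * k < tot → Empty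
  multiple-not-small (zero , rk≡0) 0<rk _ = <-irrefl (sym rk≡0) 0<rk
  multiple-not-small {r} (suc t , rk≡) _ rk<tot = <-irrefl refl (<-≤-trans rk<tot (≤-trans (m≤m+n tot (t * tot)) (≤-reflexive (sym rk≡))))

select : ∀ {m} {P : Fin m → Set} → Decidable P → Subset m
select P? = tabulate (λ e → does (P? e))

∈-select : ∀ {m} {P : Fin m → Set} (P? : Decidable P) e → Iff (e ∈ select P?) (P e)
∈-select P? e = to , from
  where
  lookup≡ : lookup (select P?) e ≡ does (P? e)
  lookup≡ = lookup∘tabulate (λ e → does (P? e)) e
  to : e ∈ select P? → _
  to e∈ with P? e | trans (sym ([]=⇒lookup e∈)) lookup≡
  ... | yes Pe | _ = Pe
  ... | no _ | ()
  from : _ → e ∈ select P?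
  from Pe = lookup⇒[]= e (select P?) (trans lookup≡ (dec-true (P? e) Pe))

_↾_ : ∀ {m} → Subset m → {R : Fin m → Set} → Decidable R → Subset m
T ↾ R? = select (λ e → (e ∈? T) ×-dec R? e)

subset-ext : ∀ {m} {p q : Subset m} → (∀ e → Iff (e ∈ p) (e ∈ q)) → p ≡ q
subset-ext p⇔q = ⊆-antisym (λ {e} → proj₁ (p⇔q e)) (λ {e} → proj₂ (p⇔q e))

∪-cancel : ∀ {m} {R : Fin m → Set} {a a′ c c′ : Subset m} →
  (∀ e → e ∈ a → R e) → (∀ e → e ∈ a′ → R e) → (∀ e → e ∈ c → ¬ R e) → (∀ e → e ∈ c′ → ¬ R e) →
  a ∪ c ≡ a′ ∪ c′ → a ≡ a′ × c ≡ c′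
∪-cancel {R = R} {a = a} {a′} {c} {c′} a⊆R a′⊆R c⊆¬R c′⊆¬R eq =
  subset-ext (λ e → left a⊆R c′⊆¬R eq , left a′⊆R c⊆¬R (sym eq)) ,
  subset-ext (λ e → right c⊆¬R a′⊆R eq , right c′⊆¬R a⊆R (sym eq))
  where
  left : ∀ {a c a′ c′ e} → (∀ e → e ∈ a → R e) → (∀ e → e ∈ c′ → ¬ R e) → a ∪ c ≡ a′ ∪ c′ → e ∈ a → e ∈ a′
  left {a} {c} {a′} {c′} {e} a⊆R c′⊆¬R eq e∈a with x∈p∪q⁻ a′ c′ (subst (e ∈_) eq (x∈p∪q⁺ (inj₁ e∈a)))
  ... | inj₁ e∈a′ = e∈a′
  ... | inj₂ e∈c′ = ⊥-elim (c′⊆¬R e e∈c′ (a⊆R e e∈a))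
  right : ∀ {a c a′ c′ e} → (∀ e → e ∈ c → ¬ R e) → (∀ e → e ∈ a′ → R e) → a ∪ c ≡ a′ ∪ c′ → e ∈ c → e ∈ c′
  right {a} {c} {a′} {c′} {e} c⊆¬R a′⊆R eq e∈c with x∈p∪q⁻ a′ c′ (subst (e ∈_) eq (x∈p∪q⁺ (inj₂ e∈c)))
  ... | inj₁ e∈a′ = ⊥-elim (c⊆¬R e e∈c (a′⊆R e e∈a′))
  ... | inj₂ e∈c′ = e∈c′

module Labelling {n m k : ℕ} (ends : Ends n m) (pop : Fin n → ℕ) (L : Vec (Fin k) n) where
  open Reachability ends

  lab : Fin n → Fin k
  lab = lookup L

  Cross : Fin m → Set
  Cross = Crossing ends pop L

  Inside : Fin k → Fin m → Set
  Inside = InsideDistrict ends pop L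

  qends : Ends k m
  qends = quotEnds ends pop L

  cross? : Decidable Cross
  cross? e = ¬? (lab (src e) ≟ᶠ lab (tgt e))

  inside? : ∀ i → Decidable (Inside i)
  inside? i e = (lab (src e) ≟ᶠ i) ×-dec (lab (tgt e) ≟ᶠ i)

  inDistrict? : ∀ i → Decidable (InDistrict ends pop L i)
  inDistrict? i v = lab v ≟ᶠ i

  ¬cross⇒same-label : ∀ {e} → ¬ Cross e → lab (src e) ≡ lab (tgt e)
  ¬cross⇒same-label {e} ¬cross with lab (src e) ≟ᶠ lab (tgt e)
  ... | yes same = same
  ... | no differ = ⊥-elim (¬cross differ)

  inside⇒¬cross : ∀ {i e} → Inside i e → ¬ Cross e
  inside⇒¬cross (src-in , tgt-in) = _$ trans src-in (sym tgt-in)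

  Preserving : (Fin m → Set) → Set
  Preserving P = ∀ f → P f → lab (src f) ≡ lab (tgt f)

  private
    variable
      P Q : Fin m → Set
      u v : Fin n

  adj-label : ∀ f {a b} → Adj (ends f) a b → lab (src f) ≡ lab (tgt f) → lab a ≡ lab b
  adj-label f (inj₁ (refl , refl)) same = same
  adj-label f (inj₂ (refl , refl)) same = sym same

  reach-label : Preserving P → Reach ends P u v → lab u ≡ lab v
  reach-label P-pres here = refl
  reach-label P-pres (step f Pf a p) = trans (adj-label f a (P-pres f Pf)) (reach-label P-pres p)

  reach-inside : ∀ {i} → Preserving P → lab u ≡ i → Reach ends P u v → Reach ends (λ f → P f × Inside i f) u v
  reach-inside P-pres lu≡i here = here
  reach-inside P-pres lu≡i (step f Pf a p) =
    step f (Pf , inside a lu≡i) a (reach-inside P-pres (trans (sym (adj-label f a (P-pres f Pf))) lu≡i) p)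
    where
    inside : ∀ {a b i} → Adj (ends f) a b → lab a ≡ i → Inside i f
    inside (inj₁ (refl , refl)) la≡i = la≡i , trans (sym (P-pres f Pf)) la≡i
    inside (inj₂ (refl , refl)) la≡i = trans (P-pres f Pf) la≡i , la≡i

  reach-quotient : Reach ends P u v → Reach qends (λ f → P f × Cross f) (lab u) (lab v)
  reach-quotient here = here
  reach-quotient (step f Pf a p) with cross? f
  ... | yes crosses = step f (Pf , crosses) (quotient-adj a) (reach-quotient p)
    where
    quotient-adj : ∀ {a b} → Adj (ends f) a b → Adj (qends f) (lab a) (lab b)
    quotient-adj (inj₁ (refl , refl)) = inj₁ (refl , refl)
    quotient-adj (inj₂ (refl , refl)) = inj₂ (refl , refl)
  ... | no ¬crosses rewrite adj-label f a (¬cross⇒same-label ¬crosses) = reach-quotient p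

  reach-lift : (∀ a b → lab a ≡ lab b → Reach ends P a b) → (∀ f → Q f → P f) →
    ∀ {i j} → Reach qends Q i j → ∀ u v → lab u ≡ i → lab v ≡ j → Reach ends P u v
  reach-lift within Q⊆P here u v lu≡ lv≡ = within u v (trans lu≡ (sym lv≡))
  reach-lift within Q⊆P (step f Qf (inj₁ (refl , refl)) p) u v lu≡ lv≡ =
    reach-trans (within u (src f) lu≡) (reach-trans (reach-edge f (Q⊆P f Qf) (Adj-src-tgt f)) (reach-lift within Q⊆P p (tgt f) v refl lv≡))
  reach-lift within Q⊆P (step f Qf (inj₂ (refl , refl)) p) u v lu≡ lv≡ =
    reach-trans (within u (tgt f) lu≡) (reach-trans (reach-edge f (Q⊆P f Qf) (Adj-sym (Adj-src-tgt f))) (reach-lift within Q⊆P p (src f) v refl lv≡))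

∈-↾ : ∀ {m} (T : Subset m) {R : Fin m → Set} (R? : Decidable R) e → Iff (e ∈ T ↾ R?) (e ∈ T × R e)
∈-↾ T R? = ∈-select (λ e → (e ∈? T) ×-dec R? e)

lookup-∈ : ∀ {n} (C : Subset n) {v} → Iff (lookup C v ≡ true) (v ∈ C)
lookup-∈ C {v} = lookup⇒[]= v C , []=⇒lookup

module _ {m : ℕ} {R : Fin m → Set} (R? : Decidable R) where

  ↾-∪ˡ : ∀ {a c} → (∀ e → e ∈ a → R e) → (∀ e → e ∈ c → ¬ R e) → (a ∪ c) ↾ R? ≡ a
  ↾-∪ˡ {a} {c} a⊆R c⊆¬R = subset-ext λ e → to e , λ e∈a → proj₂ (∈-↾ (a ∪ c) R? e) (x∈p∪q⁺ (inj₁ e∈a) , a⊆R e e∈a)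
    where
    to : ∀ e → e ∈ (a ∪ c) ↾ R? → e ∈ a
    to e e∈ with proj₁ (∈-↾ (a ∪ c) R? e) e∈
    ... | e∈a∪c , Re with x∈p∪q⁻ a c e∈a∪c
    ...   | inj₁ e∈a = e∈a
    ...   | inj₂ e∈c = ⊥-elim (c⊆¬R e e∈c Re)

  ↾-∪ʳ : ∀ {a c} → (∀ e → e ∈ a → ¬ R e) → (a ∪ c) ↾ R? ≡ c ↾ R?
  ↾-∪ʳ {a} {c} a⊆¬R = subset-ext λ e → to e , from e
    where
    to : ∀ e → e ∈ (a ∪ c) ↾ R? → e ∈ c ↾ R?
    to e e∈ with proj₁ (∈-↾ (a ∪ c) R? e) e∈
    ... | e∈a∪c , Re with x∈p∪q⁻ a c e∈a∪c
    ...   | inj₁ e∈a = ⊥-elim (a⊆¬R e e∈a Re)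
    ...   | inj₂ e∈c = proj₂ (∈-↾ c R? e) (e∈c , Re)
    from : ∀ e → e ∈ c ↾ R? → e ∈ (a ∪ c) ↾ R?
    from e e∈ with proj₁ (∈-↾ c R? e) e∈
    ... | e∈c , Re = proj₂ (∈-↾ (a ∪ c) R? e) (x∈p∪q⁺ (inj₂ e∈c) , Re)

  ↾-split : ∀ T → T ≡ (T ↾ R?) ∪ (T ↾ (¬? ∘ R?))
  ↾-split T = subset-ext λ e → to e , from e
    where
    to : ∀ e → e ∈ T → e ∈ (T ↾ R?) ∪ (T ↾ (¬? ∘ R?))
    to e e∈T with R? e
    ... | yes Re = x∈p∪q⁺ (inj₁ (proj₂ (∈-↾ T R? e) (e∈T , Re)))
    ... | no ¬Re = x∈p∪q⁺ (inj₂ (proj₂ (∈-↾ T (¬? ∘ R?) e) (e∈T , ¬Re)))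
    from : ∀ e → e ∈ (T ↾ R?) ∪ (T ↾ (¬? ∘ R?)) → e ∈ T
    from e e∈ with x∈p∪q⁻ (T ↾ R?) (T ↾ (¬? ∘ R?)) e∈
    ... | inj₁ e∈₁ = proj₁ (proj₁ (∈-↾ T R? e) e∈₁)
    ... | inj₂ e∈₂ = proj₁ (proj₁ (∈-↾ T (¬? ∘ R?) e) e∈₂)

  ↾-↾ : ∀ {Q : Fin m → Set} (Q? : Decidable Q) T → (∀ e → R e → Q e) → (T ↾ Q?) ↾ R? ≡ T ↾ R?
  ↾-↾ Q? T R⊆Q = subset-ext λ e →
    (λ e∈ → let (e∈T↾Q , Re) = proj₁ (∈-↾ (T ↾ Q?) R? e) e∈ in proj₂ (∈-↾ T R? e) (proj₁ (proj₁ (∈-↾ T Q? e) e∈T↾Q) , Re)) ,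
    (λ e∈ → let (e∈T , Re) = proj₁ (∈-↾ T R? e) e∈ in proj₂ (∈-↾ (T ↾ Q?) R? e) (proj₂ (∈-↾ T Q? e) (e∈T , R⊆Q e Re) , Re))

module Classes {n r : ℕ} (pop : Fin n → ℕ) (cls : Fin n → Fin r) where

  classPop : Fin r → ℕ
  classPop j = ∑ (λ w → onlyIf (does (cls w ≟ᶠ j)) (pop w))

  popIn : Subset n → Fin r → ℕ
  popIn C j = ∑ (λ w → onlyIf (does (cls w ≟ᶠ j)) (onlyIf (lookup C w) (pop w)))

  popSub-by-class : ∀ C → popSub pop C ≡ ∑ (popIn C)
  popSub-by-class C = trans (sum-map-allFin (λ w → onlyIf (lookup C w) (pop w))) (∑-fibres cls (λ w → onlyIf (lookup C w) (pop w)))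

  Saturates : Subset n → Fin r → Set
  Saturates C j = ∀ v w → v ∈ C → cls v ≡ j → cls w ≡ j → w ∈ C

  popIn-saturated : ∀ C j → Saturates C j → popIn C j ≡ 0 ⊎ (∃ λ v → v ∈ C × cls v ≡ j) × popIn C j ≡ classPop j
  popIn-saturated C j C-sat with Fin.any? (λ v → (v ∈? C) ×-dec (cls v ≟ᶠ j))
  ... | yes (v , v∈C , cv≡j) = inj₂ ((v , v∈C , cv≡j) , sum-cong-≗ whole)
    where
    whole : ∀ w → onlyIf (does (cls w ≟ᶠ j)) (onlyIf (lookup C w) (pop w)) ≡ onlyIf (does (cls w ≟ᶠ j)) (pop w)
    whole w with cls w ≟ᶠ j
    ... | no _ = refl
    ... | yes cw≡j rewrite proj₂ (lookup-∈ C) (C-sat v w v∈C cv≡j cw≡j) = refl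
  ... | no disjoint = inj₁ (∑-zero none)
    where
    none : ∀ w → onlyIf (does (cls w ≟ᶠ j)) (onlyIf (lookup C w) (pop w)) ≡ 0
    none w with cls w ≟ᶠ j
    ... | no _ = refl
    ... | yes cw≡j with lookup C w in w∈C
    ...   | false = refl
    ...   | true = ⊥-elim (disjoint (w , proj₁ (lookup-∈ C) w∈C , cw≡j))

  popIn-member : ∀ C {x} → x ∈ C → pop x ≤ popIn C (cls x)
  popIn-member C {x} x∈C = ≤-trans (≤-reflexive (sym term)) (∑-term-≤ _ x)
    where
    term : onlyIf (does (cls x ≟ᶠ cls x)) (onlyIf (lookup C x) (pop x)) ≡ pop x
    term rewrite dec-true (cls x ≟ᶠ cls x) refl | proj₂ (lookup-∈ C) x∈C = refl

  popIn-missing : ∀ C {y} → y ∉ C → popIn C (cls y) + pop y ≤ classPop (cls y)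
  popIn-missing C {y} y∉C = ∑-mono-gap y (pop y) pointwise at-y
    where
    pointwise : ∀ v → onlyIf (does (cls v ≟ᶠ cls y)) (onlyIf (lookup C v) (pop v)) ≤ onlyIf (does (cls v ≟ᶠ cls y)) (pop v)
    pointwise v with does (cls v ≟ᶠ cls y)
    ... | true = onlyIf-≤ (lookup C v) (pop v)
    ... | false = z≤n
    at-y : onlyIf (does (cls y ≟ᶠ cls y)) (onlyIf (lookup C y) (pop y)) + pop y ≤ onlyIf (does (cls y ≟ᶠ cls y)) (pop y)
    at-y with cls y ≟ᶠ cls y | lookup C y in y∈C
    ... | no cy≢cy | _ = ⊥-elim (cy≢cy refl)
    ... | yes _ | true = ⊥-elim (y∉C (proj₁ (lookup-∈ C) y∈C))
    ... | yes _ | false = ≤-refl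

-- Trees that output a given partition

module DistrictTrees {n m k : ℕ} (ends : Ends n m) (pop : Fin n → ℕ) (pos : ∀ v → 0 < pop v) (k≥1 : 1 ≤ k)
  (L : Vec (Fin k) n) (valid : ValidPartition ends pop L) where
  open Reachability ends
  open SpanningTrees ends
  open Labelling ends pop L
  open Multiples (popTotal pop) k
  module Quotient = SpanningTrees qends
  module QuotientReach = Reachability qends

  instance
    k≢0 : NonZero k
    k≢0 = >-nonZero k≥1

  InD : Fin k → Fin n → Set
  InD = InDistrict ends pop L

  nonempty : ∀ i → ∃ (InD i)
  nonempty = proj₁ valid

  district-pop : ∀ i → districtPop ends pop L i * k ≡ popTotal pop
  district-pop = proj₂ (proj₂ (proj₂ valid))

  crossingPart : Subset m → Subset m
  crossingPart T = T ↾ cross?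

  districtPart : Fin k → Subset m → Subset m
  districtPart i T = T ↾ inside? i

  IsQuotientTree : Subset m → Set
  IsQuotientTree S = IsSpanningTree qends All⊤ Cross S

  IsDistrictTree : Fin k → Subset m → Set
  IsDistrictTree i S = IsSpanningTree ends (InD i) (Inside i) S

  open Classes pop lab using (popIn; Saturates; popIn-member) renaming (popSub-by-class to popSub-by-district)

  districtPop≡ : ∀ j → districtPop ends pop L j ≡ Classes.classPop pop lab j
  districtPop≡ j = sum-map-allFin (λ v → onlyIf (does (lab v ≟ᶠ j)) (pop v))

  popIn-multiple : ∀ C j → Saturates C j → IsMultiple (popIn C j)
  popIn-multiple C j C-sat with Classes.popIn-saturated pop lab C j C-sat
  ... | inj₁ popIn≡0 = 0 , cong (_* k) popIn≡0
  ... | inj₂ (_ , popIn≡) = 1 , (begin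
    popIn C j * k                  ≡⟨ cong (_* k) (trans popIn≡ (sym (districtPop≡ j))) ⟩
    districtPop ends pop L j * k   ≡⟨ district-pop j ⟩
    popTotal pop                   ≡⟨ +-identityʳ _ ⟨
    1 * popTotal pop               ∎)
    where open ≡-Reasoning

  popIn-missing : ∀ C {y} → y ∉ C → popIn C (lab y) + pop y ≤ districtPop ends pop L (lab y)
  popIn-missing C y∉C = ≤-trans (Classes.popIn-missing pop lab C y∉C) (≤-reflexive (sym (districtPop≡ _)))

  component-saturates : ∀ {P : Fin m → Set} {x C} → ComponentIs ends pop k P x C →
    ∀ j {S : Fin m → Set} → Spans ends (InD j) S → (∀ f → S f → P f) → Saturates C j
  component-saturates comp j S-spans S⊆P v w v∈C lv≡j lw≡j =
    proj₂ (comp w) (reach-trans (proj₁ (comp v) v∈C) (reach-mono S⊆P (S-spans v w lv≡j lw≡j)))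

  districtPart-inside : ∀ {i T f} → f ∈ districtPart i T → f ∈ T × Inside i f
  districtPart-inside {i} {T} {f} = proj₁ (∈-↾ T (inside? i) f)

  crossingPart-crossing : ∀ {T f} → f ∈ crossingPart T → f ∈ T × Cross f
  crossingPart-crossing {T} {f} = proj₁ (∈-↾ T cross? f)

  districtPart-avoids : ∀ {i T e f} → ¬ Inside i e → f ∈ districtPart i T → (T ∖ e) f
  districtPart-avoids ¬ins f∈ = proj₁ (districtPart-inside f∈) , λ { refl → ¬ins (proj₂ (districtPart-inside f∈)) }

  module FromTrees (T : Subset m) (quotient-tree : IsQuotientTree (crossingPart T))
    (district-trees : ∀ i → IsDistrictTree i (districtPart i T)) where

    districtPart-spans : ∀ i → Spans ends (InD i) (_∈ districtPart i T)
    districtPart-spans i = proj₁ (proj₂ (district-trees i))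

    within-district : ∀ a b → lab a ≡ lab b → Reach ends (_∈ districtPart (lab a) T) a b
    within-district a b la≡lb = districtPart-spans (lab a) a b refl (sym la≡lb)

    T-spans : Spans ends All⊤ (_∈ T)
    T-spans u v _ _ =
      reach-lift (λ a b la≡lb → reach-mono (λ _ → proj₁ ∘ districtPart-inside) (within-district a b la≡lb))
        (λ _ → proj₁ ∘ crossingPart-crossing) (proj₁ (proj₂ quotient-tree) (lab u) (lab v) tt tt) u v refl refl

    quotient-size : card (_∈? crossingPart T) + 1 ≡ k
    quotient-size = trans (Quotient.tree-size (λ _ → yes tt) quotient-tree (λ _ _ → tt , tt) {fromℕ< k≥1} tt) (card-all k)

    district-size : ∀ i → card (_∈? districtPart i T) + 1 ≡ card (inDistrict? i)
    district-size i = tree-size (inDistrict? i) (district-trees i) (λ _ inside → inside) (proj₂ (nonempty i))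

    -- each edge of T is either crossing or inside exactly one district
    edge-split : ∀ e → onlyIf (does (e ∈? T)) 1 ≡
      onlyIf (does (e ∈? crossingPart T)) 1 + ∑ (λ i → onlyIf (does (e ∈? districtPart i T)) 1)
    edge-split e with e ∈? T | cross? e
    ... | no e∉T | _ = sym (cong₂ _+_ (absent (proj₁ ∘ crossingPart-crossing)) (∑-zero λ i → absent (proj₁ ∘ districtPart-inside {i})))
      where
      absent : ∀ {S} → (e ∈ S → e ∈ T) → onlyIf (does (e ∈? S)) 1 ≡ 0
      absent S⊆T = cong (λ b → onlyIf b 1) (dec-false (e ∈? _) (e∉T ∘ S⊆T))
    ... | yes e∈T | yes crosses = sym (cong₂ _+_
      (cong (λ b → onlyIf b 1) (dec-true (e ∈? crossingPart T) (proj₂ (∈-↾ T cross? e) (e∈T , crosses))))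
      (∑-zero λ i → cong (λ b → onlyIf b 1)
        (dec-false (e ∈? districtPart i T) λ e∈ → inside⇒¬cross (proj₂ (districtPart-inside e∈)) crosses)))
    ... | yes e∈T | no ¬crosses = sym (cong₂ _+_
      (cong (λ b → onlyIf b 1) (dec-false (e ∈? crossingPart T) (¬crosses ∘ proj₂ ∘ crossingPart-crossing)))
      (trans (sum-cong-≗ λ i → cong (λ b → onlyIf b 1) (does-iff (in-district i) (e ∈? districtPart i T) (i ≟ᶠ lab (src e))))
             (∑-indicator (lab (src e)) 1)))
      where
      in-district : ∀ i → Iff (e ∈ districtPart i T) (i ≡ lab (src e))
      in-district i = (λ e∈ → sym (proj₁ (proj₂ (districtPart-inside e∈)))) ,
        λ i≡ → proj₂ (∈-↾ T (inside? i) e) (e∈T , sym i≡ , trans (sym (¬cross⇒same-label ¬crosses)) (sym i≡))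

    T-size : card (_∈? T) + 1 ≡ n
    T-size = begin
      card (_∈? T) + 1                    ≡⟨ cong (_+ 1) (trans (sum-cong-≗ edge-split) (∑-distrib-+ (λ e → onlyIf (does (e ∈? crossingPart T)) 1) (λ e → ∑ (λ i → d i e)))) ⟩
      cq + ∑ (λ e → ∑ (λ i → d i e)) + 1 ≡⟨ cong (λ s → cq + s + 1) (∑-comm (λ e i → d i e)) ⟩
      cq + cd + 1                         ≡⟨ +-assoc cq cd 1 ⟩
      cq + (cd + 1)                       ≡⟨ cong (cq +_) (+-comm cd 1) ⟩
      cq + (1 + cd)                       ≡⟨ +-assoc cq 1 cd ⟨
      cq + 1 + cd                         ≡⟨ cong (_+ cd) (trans quotient-size (sym (∑-one k))) ⟩
      ∑ {k} (λ _ → 1) + cd                ≡⟨ +-comm _ cd ⟩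
      cd + ∑ {k} (λ _ → 1)                ≡⟨ ∑-distrib-+ (λ i → card (_∈? districtPart i T)) (λ _ → 1) ⟨
      ∑ (λ i → card (_∈? districtPart i T) + 1) ≡⟨ sum-cong-≗ district-size ⟩
      ∑ (λ i → card (inDistrict? i))      ≡⟨ ∑-fibres lab (λ _ → 1) ⟨
      ∑ {n} (λ _ → 1)                     ≡⟨ ∑-one n ⟩
      n                                   ∎
      where
      open ≡-Reasoning
      d : Fin k → Fin m → ℕ
      d i e = onlyIf (does (e ∈? districtPart i T)) 1
      cq = card (_∈? crossingPart T)
      cd = ∑ (λ i → card (_∈? districtPart i T))

    T-tree : IsSpanningTree ends All⊤ All⊤ T
    T-tree = (λ _ _ → tt) , T-spans , size⇒minimal T-spans T-size

    crossing⇒validCut : ∀ e → e ∈ T → Cross e → ValidCut ends pop k T e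
    crossing⇒validCut e e∈T crosses = e∈T , multiple-component (src e) , multiple-component (tgt e)
      where
      multiple-component : ∀ x C → ComponentIs ends pop k (T ∖ e) x C → IsMultiple (popSub pop C)
      multiple-component x C comp = subst IsMultiple (sym (popSub-by-district C)) (multiple-∑ (popIn C) λ j →
        popIn-multiple C j (component-saturates comp j (districtPart-spans j)
          (λ f → districtPart-avoids λ inside → inside⇒¬cross inside crosses)))

    -- cutting an edge inside district i leaves a piece of D_i whose population is strictly between 0 and I
    validCut⇒crossing : ∀ e → ValidCut ends pop k T e → Cross e
    validCut⇒crossing e (e∈T , multiple-src , _) same = multiple-not-small {popIn Cₓ i} multiple-i 0<popIn·k popIn·k<total
      where
      x = src e
      y = tgt e
      i = lab x
      Cₓ : Subset n
      Cₓ = select (Decide.reach? (T ∖ e) (T ∖? e) x)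
      comp : ComponentIs ends pop k (T ∖ e) x Cₓ
      comp = ∈-select (Decide.reach? (T ∖ e) (T ∖? e) x)
      others : ∀ j → j ≢ i → IsMultiple (popIn Cₓ j)
      others j j≢i = popIn-multiple Cₓ j (component-saturates comp j (districtPart-spans j)
        (λ f → districtPart-avoids λ inside → j≢i (sym (proj₁ inside))))
      multiple-i : IsMultiple (popIn Cₓ i)
      multiple-i = multiple-∑-remaining (popIn Cₓ) i (subst IsMultiple (popSub-by-district Cₓ) (multiple-src Cₓ comp)) others
      y∉Cₓ : y ∉ Cₓ
      y∉Cₓ = minimal⇒forest T-spans (proj₂ (proj₂ T-tree)) e e∈T ∘ proj₁ (comp y)
      popIn<I : popIn Cₓ i < districtPop ends pop L i
      popIn<I = <-≤-trans (m<m+n (popIn Cₓ i) (pos y))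
        (subst (λ j → popIn Cₓ j + pop y ≤ districtPop ends pop L j) (sym same) (popIn-missing Cₓ y∉Cₓ))
      0<popIn·k : 0 < popIn Cₓ i * k
      0<popIn·k = *-monoˡ-< k (<-≤-trans (pos x) (popIn-member Cₓ (proj₂ (comp x) here)))
      popIn·k<total : popIn Cₓ i * k < popTotal pop
      popIn·k<total = <-≤-trans (*-monoˡ-< k popIn<I) (≤-reflexive (district-pop i))

    validCuts : Count (ValidCut ends pop k T) (k ∸ 1)
    validCuts = subst (Count (ValidCut ends pop k T)) #crossing (count-cong (count-card (_∈? crossingPart T)) λ e →
      (λ e∈ → crossing⇒validCut e (proj₁ (crossingPart-crossing e∈)) (proj₂ (crossingPart-crossing e∈))) ,
      (λ cut → proj₂ (∈-↾ T cross? e) (proj₁ cut , validCut⇒crossing e cut)))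
      where
      #crossing : card (_∈? crossingPart T) ≡ k ∸ 1
      #crossing = trans (sym (m+n∸n≡m _ 1)) (cong (_∸ 1) quotient-size)

    outputs : Outputs ends pop k T L
    outputs u v = reach-label kept-preserving , λ lu≡lv → reach-mono kept (within-district u v lu≡lv)
      where
      kept-preserving : Preserving (λ f → f ∈ T × ¬ ValidCut ends pop k T f)
      kept-preserving f (f∈T , ¬cut) = ¬cross⇒same-label (¬cut ∘ crossing⇒validCut f f∈T)
      kept : ∀ f → f ∈ districtPart (lab u) T → f ∈ T × ¬ ValidCut ends pop k T f
      kept f f∈ = proj₁ (districtPart-inside f∈) , inside⇒¬cross (proj₂ (districtPart-inside f∈)) ∘ validCut⇒crossing f

  module ToTrees (T : Subset m) (accepted : Accepted ends pop k T) (outputs : Outputs ends pop k T L) where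

    T-spans : Spans ends All⊤ (_∈ T)
    T-spans = proj₁ (proj₂ (proj₁ accepted))

    T-minimal : ∀ e → e ∈ T → ¬ Spans ends All⊤ (T ∖ e)
    T-minimal = proj₂ (proj₂ (proj₁ accepted))

    kept-preserving : Preserving (λ f → f ∈ T × ¬ ValidCut ends pop k T f)
    kept-preserving f kept = proj₁ (outputs (src f) (tgt f)) (reach-edge f kept (Adj-src-tgt f))

    districtPart-spans : ∀ i → Spans ends (InD i) (_∈ districtPart i T)
    districtPart-spans i u v lu≡i lv≡i =
      reach-mono (λ f (kept , inside) → proj₂ (∈-↾ T (inside? i) f) (proj₁ kept , inside))
        (reach-inside kept-preserving lu≡i (proj₂ (outputs u v) (trans lu≡i (sym lv≡i))))

    districtPart-minimal : ∀ i e → e ∈ districtPart i T → ¬ Spans ends (InD i) (districtPart i T ∖ e)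
    districtPart-minimal i e e∈ D∖e-spans = T-minimal e (proj₁ (districtPart-inside e∈)) (spans-without bypass T-spans)
      where
      inside = proj₂ (districtPart-inside e∈)
      bypass : Reach ends (T ∖ e) (src e) (tgt e)
      bypass = reach-mono (λ f (f∈ , f≢e) → proj₁ (districtPart-inside f∈) , f≢e)
        (D∖e-spans (src e) (tgt e) (proj₁ inside) (proj₂ inside))

    crossingPart-spans : Spans qends All⊤ (_∈ crossingPart T)
    crossingPart-spans i j _ _ with nonempty i | nonempty j
    ... | u , refl | v , refl = QuotientReach.reach-mono (λ f (f∈T , crosses) → proj₂ (∈-↾ T cross? f) (f∈T , crosses))
      (reach-quotient (T-spans u v tt tt))

    crossingPart-minimal : ∀ e → e ∈ crossingPart T → ¬ Spans qends All⊤ (crossingPart T ∖ e)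
    crossingPart-minimal e e∈ Q∖e-spans = T-minimal e (proj₁ (crossingPart-crossing e∈)) λ u v _ _ →
      reach-lift within lifted (Q∖e-spans (lab u) (lab v) tt tt) u v refl refl
      where
      within : ∀ a b → lab a ≡ lab b → Reach ends (T ∖ e) a b
      within a b la≡lb = reach-mono (λ f → districtPart-avoids λ inside → inside⇒¬cross inside (proj₂ (crossingPart-crossing e∈)))
        (districtPart-spans (lab a) a b refl (sym la≡lb))
      lifted : ∀ f → (crossingPart T ∖ e) f → (T ∖ e) f
      lifted f (f∈ , f≢e) = proj₁ (crossingPart-crossing f∈) , f≢e

    quotient-tree : IsQuotientTree (crossingPart T)
    quotient-tree = (λ _ → proj₂ ∘ crossingPart-crossing) , crossingPart-spans , crossingPart-minimal

    district-trees : ∀ i → IsDistrictTree i (districtPart i T)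
    district-trees i = (λ _ → proj₂ ∘ districtPart-inside) , districtPart-spans i , districtPart-minimal i

  outputs⇔trees : ∀ T → Iff (Accepted ends pop k T × Outputs ends pop k T L)
    (IsQuotientTree (crossingPart T) × (∀ i → IsDistrictTree i (districtPart i T)))
  outputs⇔trees T =
    (λ (accepted , outputs) → ToTrees.quotient-tree T accepted outputs , ToTrees.district-trees T accepted outputs) ,
    (λ (quotient-tree , district-trees) → let open FromTrees T quotient-tree district-trees in (T-tree , validCuts) , outputs)

module OutputCount {n m k : ℕ} (ends : Ends n m) (pop : Fin n → ℕ) (pos : ∀ v → 0 < pop v) (k≥1 : 1 ≤ k)
  (L : Vec (Fin k) n) (valid : ValidPartition ends pop L) where
  open Reachability ends using (src)
  open Labelling ends pop L
  open DistrictTrees ends pop pos k≥1 L valid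

  DistrictForest : List (Fin k) → Subset m → Set
  DistrictForest is c = (∀ e → e ∈ c → ∃ λ i → i ∈ₗ is × Inside i e) × (∀ i → i ∈ₗ is → IsDistrictTree i (districtPart i c))

  inside-unique : ∀ {i j e} → Inside i e → Inside j e → i ≡ j
  inside-unique (src-i , _) (src-j , _) = trans (sym src-i) src-j

  count-districtForests : (wd : Fin k → ℕ) → (∀ i → STCount ends (InD i) (Inside i) (wd i)) →
    ∀ is → Unique is → Count (DistrictForest is) (product (map wd is))
  count-districtForests wd counts [] [] = ⊥ ∷ [] , [] ∷ [] , (λ b → to b , from b) , refl
    where
    to : ∀ b → DistrictForest [] b → b ∈ₗ ⊥ ∷ []
    to b (b-inside , _) = here (subset-ext λ e → none e , ⊥-elim ∘ ∉⊥)
      where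
      none : ∀ e → e ∈ b → e ∈ ⊥
      none e e∈b with b-inside e e∈b
      ... | _ , () , _
    from : ∀ b → b ∈ₗ ⊥ ∷ [] → DistrictForest [] b
    from b (here refl) = (λ _ e∈⊥ → ⊥-elim (∉⊥ e∈⊥)) , λ _ ()
  count-districtForests wd counts (i ∷ is) (i∉is ∷ is!) =
    count-product _∪_ (counts i) (count-districtForests wd counts is is!)
      (λ a-tree a′-tree c-forest c′-forest → ∪-cancel (proj₁ a-tree) (proj₁ a′-tree) (outside c-forest) (outside c′-forest))
      (λ b → split b , join b)
    where
    outside : ∀ {c} → DistrictForest is c → ∀ e → e ∈ c → ¬ Inside i e
    outside (c-inside , _) e e∈c inside-i with c-inside e e∈c
    ... | j , j∈is , inside-j = All.lookup i∉is j∈is (inside-unique inside-i inside-j)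

    split : ∀ b → DistrictForest (i ∷ is) b → ∃₂ λ a c → IsDistrictTree i a × DistrictForest is c × b ≡ a ∪ c
    split b (b-inside , b-trees) = districtPart i b , c , b-trees i (here refl) , (c-inside , c-trees) , ↾-split (inside? i) b
      where
      c = b ↾ (¬? ∘ inside? i)
      c-inside : ∀ e → e ∈ c → ∃ λ j → j ∈ₗ is × Inside j e
      c-inside e e∈c with proj₁ (∈-↾ b (¬? ∘ inside? i) e) e∈c
      ... | e∈b , ¬inside-i with b-inside e e∈b
      ...   | j , here refl , inside-j = ⊥-elim (¬inside-i inside-j)
      ...   | j , there j∈is , inside-j = j , j∈is , inside-j
      c-trees : ∀ j → j ∈ₗ is → IsDistrictTree j (districtPart j c)
      c-trees j j∈is = subst (IsDistrictTree j)
        (sym (↾-↾ (inside? j) (¬? ∘ inside? i) b λ e inside-j inside-i → All.lookup i∉is j∈is (inside-unique inside-i inside-j)))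
        (b-trees j (there j∈is))

    join : ∀ b → (∃₂ λ a c → IsDistrictTree i a × DistrictForest is c × b ≡ a ∪ c) → DistrictForest (i ∷ is) b
    join b (a , c , a-tree , (c-inside , c-trees) , refl) = ac-inside , ac-trees
      where
      ac-inside : ∀ e → e ∈ a ∪ c → ∃ λ j → j ∈ₗ i ∷ is × Inside j e
      ac-inside e e∈ with x∈p∪q⁻ a c e∈
      ... | inj₁ e∈a = i , here refl , proj₁ a-tree e e∈a
      ... | inj₂ e∈c with c-inside e e∈c
      ...   | j , j∈is , inside-j = j , there j∈is , inside-j
      ac-trees : ∀ j → j ∈ₗ i ∷ is → IsDistrictTree j (districtPart j (a ∪ c))
      ac-trees j (here refl) =
        subst (IsDistrictTree i) (sym (↾-∪ˡ (inside? i) (proj₁ a-tree) (outside (c-inside , c-trees)))) a-tree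
      ac-trees j (there j∈is) = subst (IsDistrictTree j)
        (sym (↾-∪ʳ (inside? j) λ e e∈a inside-j → All.lookup i∉is j∈is (inside-unique (proj₁ a-tree e e∈a) inside-j)))
        (c-trees j j∈is)

  Decomposed : Subset m → Set
  Decomposed T = IsQuotientTree (crossingPart T) × (∀ i → IsDistrictTree i (districtPart i T))

  -- T ↦ (T ∩ crossing edges, T ∩ edges of each district) is a bijection onto the tuples of spanning trees
  count-decomposed : ∀ {wq} {wd : Fin k → ℕ} → STCount qends All⊤ Cross wq → (∀ i → STCount ends (InD i) (Inside i) (wd i)) →
    Count Decomposed (wq * product (map wd (allFin k)))
  count-decomposed {wd = wd} quotient-count district-counts =
    count-product _∪_ quotient-count (count-districtForests wd district-counts (allFin k) (allFin⁺ k))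
      (λ q-tree q′-tree c-forest c′-forest → ∪-cancel (proj₁ q-tree) (proj₁ q′-tree) (uncrossed c-forest) (uncrossed c′-forest))
      (λ T → split T , join T)
    where
    uncrossed : ∀ {c} → DistrictForest (allFin k) c → ∀ e → e ∈ c → ¬ Cross e
    uncrossed (c-inside , _) e e∈c = inside⇒¬cross (proj₂ (proj₂ (c-inside e e∈c)))

    split : ∀ T → Decomposed T → ∃₂ λ q c → IsQuotientTree q × DistrictForest (allFin k) c × T ≡ q ∪ c
    split T (q-tree , d-trees) = crossingPart T , c , q-tree , (c-inside , c-trees) , ↾-split cross? T
      where
      c = T ↾ (¬? ∘ cross?)
      c-inside : ∀ e → e ∈ c → ∃ λ i → i ∈ₗ allFin k × Inside i e
      c-inside e e∈c = lab (src e) , ∈-allFin _ , refl , sym (¬cross⇒same-label (proj₂ (proj₁ (∈-↾ T (¬? ∘ cross?) e) e∈c)))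
      c-trees : ∀ i → i ∈ₗ allFin k → IsDistrictTree i (districtPart i c)
      c-trees i _ = subst (IsDistrictTree i) (sym (↾-↾ (inside? i) (¬? ∘ cross?) T λ _ → inside⇒¬cross)) (d-trees i)

    join : ∀ T → (∃₂ λ q c → IsQuotientTree q × DistrictForest (allFin k) c × T ≡ q ∪ c) → Decomposed T
    join T (q , c , q-tree , c-forest , refl) =
      subst IsQuotientTree (sym (↾-∪ˡ cross? (proj₁ q-tree) (uncrossed c-forest))) q-tree ,
      λ i → subst (IsDistrictTree i) (sym (↾-∪ʳ (inside? i) λ e e∈q inside → inside⇒¬cross inside (proj₁ q-tree e e∈q)))
        (proj₂ c-forest i (∈-allFin i))

  count-outputs : ∀ w → Weight ends pop L w → Count (λ T → Accepted ends pop k T × Outputs ends pop k T L) w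
  count-outputs _ (_ , _ , quotient-count , district-counts , refl) =
    count-cong (count-decomposed quotient-count district-counts) λ T → swap (outputs⇔trees T)

-- The partition output by an accepted tree

module Ranking {n : ℕ} {P : Fin n → Set} (P? : Decidable P) where

  Below : ℕ → Fin n → Set
  Below j u = P u × toℕ u < j

  below? : ∀ j → Decidable (Below j)
  below? j u = P? u ×-dec (toℕ u <? j)

  rank : ℕ → ℕ
  rank j = card (below? j)

  rank-0 : rank 0 ≡ 0
  rank-0 = card-∅ (below? 0) λ _ ()

  rank-all : rank n ≡ card P?
  rank-all = card-cong (below? n) P? λ u → proj₁ , (_, Fin.toℕ<n u)

  rank-mono : ∀ {j j′} → j ≤ j′ → rank j ≤ rank j′
  rank-mono j≤j′ = card-mono (below? _) (below? _) λ u (Pu , u<j) → Pu , <-≤-trans u<j j≤j′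

  rank-< : ∀ {u j} → P u → toℕ u < j → rank (toℕ u) < rank j
  rank-< {u} {j} Pu u<j = subst (_≤ rank j) (+-comm (rank (toℕ u)) 1)
    (card-< (below? (toℕ u)) (below? j) u (λ w (Pw , w<u) → Pw , <-trans w<u u<j) (λ (_ , u<u) → <-irrefl refl u<u) (Pu , u<j))

  rank-suc : ∀ u → rank (suc (toℕ u)) ≡ rank (toℕ u) + onlyIf (does (P? u)) 1
  rank-suc u with P? u
  ... | yes Pu = sym (card-insert (below? (toℕ u)) (below? (suc (toℕ u))) u same (λ (_ , u<u) → <-irrefl refl u<u) (Pu , ≤-refl))
    where
    same : ∀ w → w ≢ u → Iff (Below (toℕ u) w) (Below (suc (toℕ u)) w)
    same w w≢u = (λ (Pw , w<u) → Pw , m≤n⇒m≤1+n w<u) ,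
      λ (Pw , w≤u) → Pw , ≤∧≢⇒< (s≤s⁻¹ w≤u) (w≢u ∘ Fin.toℕ-injective)
  ... | no ¬Pu = trans (card-cong (below? (suc (toℕ u))) (below? (toℕ u)) same) (sym (+-identityʳ _))
    where
    same : ∀ w → Iff (Below (suc (toℕ u)) w) (Below (toℕ u) w)
    same w = (λ (Pw , w≤u) → Pw , ≤∧≢⇒< (s≤s⁻¹ w≤u) λ w≡u → ¬Pu (subst P (Fin.toℕ-injective w≡u) Pw)) ,
      λ (Pw , w<u) → Pw , m≤n⇒m≤1+n w<u

  rank-injective : ∀ {u u′} → P u → P u′ → rank (toℕ u) ≡ rank (toℕ u′) → u ≡ u′
  rank-injective {u} {u′} Pu Pu′ eq with Fin.<-cmp u u′
  ... | tri< u<u′ _ _ = ⊥-elim (<-irrefl eq (rank-< Pu u<u′))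
  ... | tri≈ _ u≡u′ _ = u≡u′
  ... | tri> _ _ u′<u = ⊥-elim (<-irrefl (sym eq) (rank-< Pu′ u′<u))

  -- the rank grows by steps of at most one, so it takes every value below its final one
  rank-surjective : ∀ j → j ≤ n → ∀ t → t < rank j → ∃ λ u → P u × rank (toℕ u) ≡ t
  rank-surjective zero _ t t<r = ⊥-elim (n≮0 (subst (t <_) rank-0 t<r))
  rank-surjective (suc j) j<n t t<r with t <? rank j
  ... | yes t<rj = rank-surjective j (<⇒≤ j<n) t t<rj
  ... | no t≮rj = at-j (P? u) (subst (λ i → rank (suc i) ≡ rank i + onlyIf (does (P? u)) 1) (Fin.toℕ-fromℕ< j<n) (rank-suc u))
    where
    u = fromℕ< j<n
    at-j : (Pu? : Dec (P u)) → rank (suc j) ≡ rank j + onlyIf (does Pu?) 1 → ∃ λ w → P w × rank (toℕ w) ≡ t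
    at-j (yes Pu) eq = u , Pu , trans (cong rank (Fin.toℕ-fromℕ< j<n))
      (≤-antisym (≮⇒≥ t≮rj) (s≤s⁻¹ (subst (t <_) (trans eq (+-comm (rank j) 1)) t<r)))
    at-j (no _) eq = ⊥-elim (t≮rj (subst (t <_) (trans eq (+-identityʳ (rank j))) t<r))

module Reconstruction {n m k : ℕ} (ends : Ends n m) (pop : Fin n → ℕ) (pos : ∀ v → 0 < pop v) (k≥1 : 1 ≤ k)
  (T : Subset m) (accepted : Accepted ends pop k T) (v₀ : Fin n) where
  open Reachability ends
  open SpanningTrees ends
  open Multiples (popTotal pop) k

  T-spans : Spans ends All⊤ (_∈ T)
  T-spans = proj₁ (proj₂ (proj₁ accepted))

  T-forest : Forest (_∈ T)
  T-forest = minimal⇒forest T-spans (proj₂ (proj₂ (proj₁ accepted)))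

  Cut : Fin m → Set
  Cut = ValidCut ends pop k T

  cuts : List (Fin m)
  cuts = proj₁ (proj₂ accepted)

  cut⇔ : ∀ e → Iff (Cut e) (e ∈ₗ cuts)
  cut⇔ = proj₁ (proj₂ (proj₂ (proj₂ accepted)))

  Kept : List (Fin m) → Fin m → Set
  Kept ys f = f ∈ T × ¬ f ∈ₗ ys

  kept? : ∀ ys → Decidable (Kept ys)
  kept? ys f = (f ∈? T) ×-dec ¬? (any? (f ≟ᶠ_) ys)

  componentPop : List (Fin m) → Fin n → ℕ
  componentPop ys = Classes.classPop pop (Components.leader ends (Kept ys) (kept? ys))

  AllMultiple : List (Fin m) → Set
  AllMultiple ys = ∀ ℓ → IsMultiple (componentPop ys ℓ)

  all-multiple-[] : AllMultiple []
  all-multiple-[] ℓ with Fin.any? (λ w → leader w ≟ᶠ ℓ)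
    where open Components ends (Kept []) (kept? [])
  ... | no none = 0 , cong (_* k) (∑-zero λ w → cong (λ b → onlyIf b (pop w)) (dec-false (_ ≟ᶠ ℓ) λ eq → none (w , eq)))
  ... | yes (w₀ , lw₀≡ℓ) = k , (begin
    componentPop [] ℓ * k ≡⟨ cong (_* k) (trans (sum-cong-≗ everyone) (sym (sum-map-allFin pop))) ⟩
    popTotal pop * k      ≡⟨ *-comm _ k ⟩
    k * popTotal pop      ∎)
    where
    open ≡-Reasoning
    open Components ends (Kept []) (kept? [])
    everyone : ∀ w → onlyIf (does (leader w ≟ᶠ ℓ)) (pop w) ≡ pop w
    everyone w = cong (λ b → onlyIf b (pop w)) (dec-true (_ ≟ᶠ ℓ)
      (trans (sym (leader-cong (reach-mono (λ f f∈T → f∈T , λ ()) (T-spans w₀ w tt tt)))) lw₀≡ℓ))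

  -- cutting a further valid cut e splits one component into the two sides of e within it
  module CutStep (e : Fin m) (ys : List (Fin m)) (cut : Cut e) (ih : AllMultiple ys) where
    module CS = Components ends (Kept ys) (kept? ys)
    module CQ = Components ends (Kept (e ∷ ys)) (kept? (e ∷ ys))

    Q⊆S : ∀ f → Kept (e ∷ ys) f → Kept ys f
    Q⊆S f (f∈T , f∉) = f∈T , f∉ ∘ there

    S⊆Q+e : ∀ f → Kept ys f → Kept (e ∷ ys) f ⊎ f ≡ e
    S⊆Q+e f (f∈T , f∉ys) with f ≟ᶠ e
    ... | yes f≡e = inj₂ f≡e
    ... | no f≢e = inj₁ (f∈T , λ { (here f≡e) → f≢e f≡e ; (there f∈ys) → f∉ys f∈ys })

    Q⊆T∖e : ∀ f → Kept (e ∷ ys) f → (T ∖ e) f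
    Q⊆T∖e f (f∈T , f∉) = f∈T , f∉ ∘ here

    nonleader : ∀ ℓ → ¬ CQ.IsLeader ℓ → componentPop (e ∷ ys) ℓ ≡ 0
    nonleader ℓ ¬isL = ∑-zero λ w → cong (λ b → onlyIf b (pop w))
      (dec-false (_ ≟ᶠ ℓ) λ lw≡ℓ → ¬isL (trans (cong CQ.leader (sym lw≡ℓ)) (trans (CQ.leader-idem w) lw≡ℓ)))

    apart : ∀ ℓ → CQ.IsLeader ℓ → ¬ Reach ends (Kept (e ∷ ys)) ℓ (src e) → ¬ Reach ends (Kept (e ∷ ys)) ℓ (tgt e) →
      IsMultiple (componentPop (e ∷ ys) ℓ)
    apart ℓ isL ℓ≁x ℓ≁y = subst IsMultiple (sym same-class) (ih (CS.leader ℓ))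
      where
      to : ∀ w → CQ.leader w ≡ ℓ → CS.leader w ≡ CS.leader ℓ
      to w lw≡ℓ = sym (CS.leader-cong (reach-mono Q⊆S (CQ.leader-reach⁻ (trans isL (sym lw≡ℓ)))))
      from : ∀ w → CS.leader w ≡ CS.leader ℓ → CQ.leader w ≡ ℓ
      from w eq with reach-via-edge e S⊆Q+e (CS.leader-reach⁻ (sym eq))
      ... | avoiding p = trans (sym (CQ.leader-cong p)) isL
      ... | forward p _ = ⊥-elim (ℓ≁x p)
      ... | backward p _ = ⊥-elim (ℓ≁y p)
      same-class : componentPop (e ∷ ys) ℓ ≡ componentPop ys (CS.leader ℓ)
      same-class = sum-cong-≗ λ w → cong (λ b → onlyIf b (pop w))
        (does-iff (to w , from w) (CQ.leader w ≟ᶠ ℓ) (CS.leader w ≟ᶠ CS.leader ℓ))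

    module _ (z : Fin n) where
      open Classes pop CQ.leader using (Saturates)

      sideOf : Subset n
      sideOf = select (Decide.reach? (T ∖ e) (T ∖? e) z)

      sideOf-component : ComponentIs ends pop k (T ∖ e) z sideOf
      sideOf-component = ∈-select (Decide.reach? (T ∖ e) (T ∖? e) z)

      sideOf-saturates : ∀ j → Saturates sideOf j
      sideOf-saturates j v w v∈C lv≡j lw≡j = proj₂ (sideOf-component w)
        (reach-trans (proj₁ (sideOf-component v) v∈C) (reach-mono Q⊆T∖e (CQ.leader-reach⁻ (trans lv≡j (sym lw≡j)))))

    -- the side of e containing z is the component of z plus components reaching neither end of e
    side : ∀ z z′ → (∀ C → ComponentIs ends pop k (T ∖ e) z C → IsMultiple (popSub pop C)) → ¬ Reach ends (T ∖ e) z z′ →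
      (∀ ℓ → CQ.IsLeader ℓ → ¬ Reach ends (Kept (e ∷ ys)) ℓ z → ¬ Reach ends (Kept (e ∷ ys)) ℓ z′ → IsMultiple (componentPop (e ∷ ys) ℓ)) →
      IsMultiple (componentPop (e ∷ ys) (CQ.leader z))
    side z z′ side-multiple z≁z′ apart′ with popIn-saturated (sideOf z) (CQ.leader z) (sideOf-saturates z _)
      where open Classes pop CQ.leader
    ... | inj₁ own≡0 = ⊥-elim (<-irrefl refl (<-≤-trans (pos z)
      (subst (pop z ≤_) own≡0 (popIn-member (sideOf z) (proj₂ (sideOf-component z z) here)))))
      where open Classes pop CQ.leader
    ... | inj₂ (_ , own≡) = subst IsMultiple own≡ (multiple-∑-remaining (popIn (sideOf z)) (CQ.leader z)
          (subst IsMultiple (popSub-by-class (sideOf z)) (side-multiple (sideOf z) (sideOf-component z))) others)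
      where
      open Classes pop CQ.leader
      others : ∀ j → j ≢ CQ.leader z → IsMultiple (popIn (sideOf z) j)
      others j j≢ with popIn-saturated (sideOf z) j (sideOf-saturates z j)
      ... | inj₁ popIn≡0 = subst IsMultiple (sym popIn≡0) multiple-0
      ... | inj₂ ((w , w∈C , lw≡j) , popIn≡) = subst IsMultiple (sym popIn≡) (apart′ j j-leader j≁z j≁z′)
        where
        j-leader : CQ.IsLeader j
        j-leader = trans (cong CQ.leader (sym lw≡j)) (trans (CQ.leader-idem w) lw≡j)
        j≁z : ¬ Reach ends (Kept (e ∷ ys)) j z
        j≁z p = j≢ (trans (sym j-leader) (CQ.leader-cong p))
        j≁z′ : ¬ Reach ends (Kept (e ∷ ys)) j z′
        j≁z′ p = z≁z′ (reach-trans (proj₁ (sideOf-component z w) w∈C)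
          (reach-mono Q⊆T∖e (reach-trans (CQ.leader-reach⁻ (trans lw≡j (sym j-leader))) p)))

    x≁y : ¬ Reach ends (T ∖ e) (src e) (tgt e)
    x≁y = T-forest e (proj₁ cut)

    all-multiple : AllMultiple (e ∷ ys)
    all-multiple ℓ with CQ.isLeader? ℓ
    ... | no ¬isL = subst IsMultiple (sym (nonleader ℓ ¬isL)) multiple-0
    ... | yes isL with Decide.reach? (Kept (e ∷ ys)) (kept? (e ∷ ys)) ℓ (src e)
                     | Decide.reach? (Kept (e ∷ ys)) (kept? (e ∷ ys)) ℓ (tgt e)
    ...   | yes ℓ~x | _ = subst (IsMultiple ∘ componentPop (e ∷ ys)) (trans (sym (CQ.leader-cong ℓ~x)) isL)
      (side (src e) (tgt e) (proj₁ (proj₂ cut)) x≁y apart)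
    ...   | no _ | yes ℓ~y = subst (IsMultiple ∘ componentPop (e ∷ ys)) (trans (sym (CQ.leader-cong ℓ~y)) isL)
      (side (tgt e) (src e) (proj₂ (proj₂ cut)) (x≁y ∘ reach-sym) λ j isL′ j≁y j≁x → apart j isL′ j≁x j≁y)
    ...   | no ℓ≁x | no ℓ≁y = apart ℓ isL ℓ≁x ℓ≁y


  all-multiple : ∀ ys → (∀ e → e ∈ₗ ys → Cut e) → AllMultiple ys
  all-multiple [] _ = all-multiple-[]
  all-multiple (e ∷ ys) ys-cut = CutStep.all-multiple e ys (ys-cut e (here refl)) (all-multiple ys (λ f → ys-cut f ∘ there))

  F : Fin m → Set
  F = Kept cuts

  module CF = Components ends F (kept? cuts)

  F-forest : Forest F
  F-forest e (e∈T , _) = T-forest e e∈T ∘ reach-mono λ f ((f∈T , _) , f≢e) → f∈T , f≢e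

  #components≡k : CF.#components ≡ k
  #components≡k = +-cancelʳ-≡ (card (kept? cuts)) CF.#components k (begin
    CF.#components + card (kept? cuts)          ≡⟨ EdgeCount.forest-count ends F (kept? cuts) F-forest ⟩
    n                                           ≡⟨ trans (tree-size (λ _ → yes tt) (proj₁ accepted) (λ _ _ → tt , tt) {v₀} tt) (card-all n) ⟨
    card (_∈? T) + 1                            ≡⟨ cong (_+ 1) kept+cut ⟨
    card (kept? cuts) + card cut? + 1           ≡⟨ +-assoc (card (kept? cuts)) _ 1 ⟩
    card (kept? cuts) + (card cut? + 1)         ≡⟨ cong (λ c → card (kept? cuts) + (c + 1)) #cuts ⟩
    card (kept? cuts) + (k ∸ 1 + 1)             ≡⟨ cong (card (kept? cuts) +_) (m∸n+n≡m k≥1) ⟩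
    card (kept? cuts) + k                       ≡⟨ +-comm (card (kept? cuts)) k ⟩
    k + card (kept? cuts)                       ∎)
    where
    open ≡-Reasoning
    cut? : Decidable (_∈ₗ cuts)
    cut? e = any? (e ≟ᶠ_) cuts
    #cuts : card cut? ≡ k ∸ 1
    #cuts = sym (Count⇒≡card cut? (count-cong (proj₂ accepted) cut⇔))
    kept+cut : card (kept? cuts) + card cut? ≡ card (_∈? T)
    kept+cut = trans (sym (∑-distrib-+ (λ e → onlyIf (does (kept? cuts e)) 1) (λ e → onlyIf (does (cut? e)) 1))) (sum-cong-≗ pointwise)
      where
      pointwise : ∀ e → onlyIf (does (kept? cuts e)) 1 + onlyIf (does (cut? e)) 1 ≡ onlyIf (does (e ∈? T)) 1
      pointwise e with e ∈? T | cut? e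
      ... | yes _ | yes _ = refl
      ... | yes _ | no _ = refl
      ... | no e∉T | yes e∈cuts = ⊥-elim (e∉T (proj₁ (proj₂ (cut⇔ e) e∈cuts)))
      ... | no _ | no _ = refl

  instance
    total≢0 : NonZero (popTotal pop)
    total≢0 = >-nonZero (<-≤-trans (pos v₀) (≤-trans (∑-term-≤ pop v₀) (≤-reflexive (sym (sum-map-allFin pop)))))

  multiplier : Fin n → ℕ
  multiplier ℓ = proj₁ (all-multiple cuts (λ e → proj₂ (cut⇔ e)) ℓ)

  multiplier-eq : ∀ ℓ → componentPop cuts ℓ * k ≡ multiplier ℓ * popTotal pop
  multiplier-eq ℓ = proj₂ (all-multiple cuts (λ e → proj₂ (cut⇔ e)) ℓ)

  ∑-multiplier : ∑ multiplier ≡ k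
  ∑-multiplier = *-cancelʳ-≡ (∑ multiplier) k (popTotal pop) (begin
    ∑ multiplier * popTotal pop               ≡⟨ *-distribʳ-sum (popTotal pop) multiplier ⟩
    ∑ (λ ℓ → multiplier ℓ * popTotal pop)     ≡⟨ sum-cong-≗ multiplier-eq ⟨
    ∑ (λ ℓ → componentPop cuts ℓ * k)         ≡⟨ *-distribʳ-sum k (componentPop cuts) ⟨
    ∑ (componentPop cuts) * k                 ≡⟨ cong (_* k) (trans (sum-map-allFin pop) (∑-fibres CF.leader pop)) ⟨
    popTotal pop * k                          ≡⟨ *-comm (popTotal pop) k ⟩
    k * popTotal pop                          ∎)
    where open ≡-Reasoning

  multiplier-positive : ∀ ℓ → CF.IsLeader ℓ → 1 ≤ multiplier ℓ
  multiplier-positive ℓ isL with multiplier ℓ | multiplier-eq ℓ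
  ... | suc _ | _ = s≤s z≤n
  ... | zero | eq = ⊥-elim (<-irrefl (sym eq) (*-monoˡ-< k own>0))
    where
    instance
      k≢0 : NonZero k
      k≢0 = >-nonZero k≥1
    own>0 : 0 < componentPop cuts ℓ
    own>0 = <-≤-trans (pos ℓ) (≤-trans (≤-reflexive (sym (cong (λ b → onlyIf b (pop ℓ)) (dec-true (CF.leader ℓ ≟ᶠ ℓ) isL))))
      (∑-term-≤ (λ w → onlyIf (does (CF.leader w ≟ᶠ ℓ)) (pop w)) ℓ))

  -- k leaders, each with multiplier ≥ 1, and multipliers summing to k: every component has population exactly I
  exact : ∀ ℓ → CF.IsLeader ℓ → componentPop cuts ℓ * k ≡ popTotal pop
  exact ℓ isL = trans (multiplier-eq ℓ) (trans (cong (_* popTotal pop) (sym one)) (+-identityʳ _))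
    where
    leader-multiplier : ∀ ℓ → onlyIf (does (CF.isLeader? ℓ)) 1 ≤ multiplier ℓ
    leader-multiplier ℓ with CF.isLeader? ℓ
    ... | yes isL = multiplier-positive ℓ isL
    ... | no _ = z≤n
    one : 1 ≡ multiplier ℓ
    one = trans (cong (λ b → onlyIf b 1) (sym (dec-true (CF.isLeader? ℓ) isL)))
      (∑-pointwise-≡ leader-multiplier (trans #components≡k (sym ∑-multiplier)) ℓ)

  open Ranking CF.isLeader?

  rank-bound : ∀ v → rank (toℕ (CF.leader v)) < k
  rank-bound v = <-≤-trans (rank-< (CF.leader-idem v) (Fin.toℕ<n _)) (≤-reflexive (trans rank-all #components≡k))

  -- the district of v is numbered by the rank of its leader among all leaders
  L′ : Vec (Fin k) n
  L′ = tabulate (λ v → fromℕ< (rank-bound v))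

  toℕ-label : ∀ v → toℕ (lookup L′ v) ≡ rank (toℕ (CF.leader v))
  toℕ-label v = trans (cong toℕ (lookup∘tabulate (λ v → fromℕ< (rank-bound v)) v)) (Fin.toℕ-fromℕ< (rank-bound v))

  label⇔leader : ∀ u v → Iff (lookup L′ u ≡ lookup L′ v) (CF.leader u ≡ CF.leader v)
  label⇔leader u v =
    (λ eq → rank-injective (CF.leader-idem u) (CF.leader-idem v) (trans (sym (toℕ-label u)) (trans (cong toℕ eq) (toℕ-label v)))) ,
    (λ eq → Fin.toℕ-injective (trans (toℕ-label u) (trans (cong (rank ∘ toℕ) eq) (sym (toℕ-label v)))))

  leaderOf : (i : Fin k) → ∃ λ ℓ → CF.IsLeader ℓ × rank (toℕ ℓ) ≡ toℕ i
  leaderOf i = rank-surjective n ≤-refl (toℕ i) (subst (toℕ i <_) (sym (trans rank-all #components≡k)) (Fin.toℕ<n i))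

  label-leaderOf : ∀ i → lookup L′ (proj₁ (leaderOf i)) ≡ i
  label-leaderOf i with leaderOf i
  ... | ℓ , isL , rank≡ = Fin.toℕ-injective (trans (toℕ-label ℓ) (trans (cong (rank ∘ toℕ) isL) rank≡))

  in-district⇔ : ∀ i v → Iff (lookup L′ v ≡ i) (CF.leader v ≡ proj₁ (leaderOf i))
  in-district⇔ i v =
    (λ lv≡i → trans (proj₁ (label⇔leader v ℓ) (trans lv≡i (sym (label-leaderOf i)))) ℓ-leader) ,
    (λ lv≡ℓ → trans (proj₂ (label⇔leader v ℓ) (trans lv≡ℓ (sym ℓ-leader))) (label-leaderOf i))
    where
    ℓ = proj₁ (leaderOf i)
    ℓ-leader = proj₁ (proj₂ (leaderOf i))

  valid : ValidPartition ends pop L′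
  valid = (λ i → proj₁ (leaderOf i) , label-leaderOf i) , canonical , connected , exact-pop
    where
    canonical : ∀ (i j : Fin k) → i <ᶠ j → ∀ v → lookup L′ v ≡ j → ∃ λ u → u <ᶠ v × lookup L′ u ≡ i
    canonical i j i<j v lv≡j = ℓ , <-≤-trans ℓ<lv (CF.leader-≤ v) , label-leaderOf i
      where
      ℓ = proj₁ (leaderOf i)
      ℓ<lv : ℓ <ᶠ CF.leader v
      ℓ<lv = ≰⇒> λ lv≤ℓ → <⇒≱ i<j (begin
        toℕ j                      ≡⟨ cong toℕ lv≡j ⟨
        toℕ (lookup L′ v)          ≡⟨ toℕ-label v ⟩
        rank (toℕ (CF.leader v))   ≤⟨ rank-mono lv≤ℓ ⟩
        rank (toℕ ℓ)               ≡⟨ proj₂ (proj₂ (leaderOf i)) ⟩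
        toℕ i                      ∎)
        where open ≤-Reasoning
    connected : ∀ i → Spans ends (InDistrict ends pop L′ i) (InsideDistrict ends pop L′ i)
    connected i u v lu≡i lv≡i = reach-mono (λ _ → proj₂)
      (reach-inside F-preserving lu≡i (CF.leader-reach⁻ (proj₁ (label⇔leader u v) (trans lu≡i (sym lv≡i)))))
      where
      open Labelling ends pop L′ using (Preserving; reach-inside)
      F-preserving : Preserving F
      F-preserving f Ff = proj₂ (label⇔leader _ _) (CF.leader-cong (reach-edge f Ff (Adj-src-tgt f)))
    exact-pop : ∀ i → districtPop ends pop L′ i * k ≡ popTotal pop
    exact-pop i = trans (cong (_* k) (trans (sum-map-allFin (λ v → onlyIf (does (lookup L′ v ≟ᶠ i)) (pop v)))
        (sum-cong-≗ λ v → cong (λ b → onlyIf b (pop v)) (does-iff (in-district⇔ i v) (lookup L′ v ≟ᶠ i) (CF.leader v ≟ᶠ _)))))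
      (exact (proj₁ (leaderOf i)) (proj₁ (proj₂ (leaderOf i))))

  outputs : Outputs ends pop k T L′
  outputs u v = (λ p → proj₂ (label⇔leader u v) (CF.leader-cong (reach-mono kept p))) ,
    λ eq → reach-mono unkept (CF.leader-reach⁻ (proj₁ (label⇔leader u v) eq))
    where
    kept : ∀ f → f ∈ T × ¬ Cut f → F f
    kept f (f∈T , ¬cut) = f∈T , ¬cut ∘ proj₂ (cut⇔ f)
    unkept : ∀ f → F f → f ∈ T × ¬ Cut f
    unkept f (f∈T , f∉cuts) = f∈T , f∉cuts ∘ proj₁ (cut⇔ f)

-- Canonical labellings and the count of accepted trees

∈⇒≤sum : ∀ {xs : List ℕ} {x} → x ∈ₗ xs → x ≤ sum xs
∈⇒≤sum (here refl) = m≤m+n _ _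
∈⇒≤sum {y ∷ _} (there x∈) = ≤-trans (∈⇒≤sum x∈) (m≤n+m _ y)

Canonical : ∀ {n k} → Vec (Fin k) n → Set
Canonical L = ∀ i j → i <ᶠ j → ∀ v → lookup L v ≡ j → ∃ λ u → u <ᶠ v × lookup L u ≡ i

-- comparing labels at the first vertex where two canonical labellings could differ
canonical-unique : ∀ {n k} {L₁ L₂ : Vec (Fin k) n} → Canonical L₁ → Canonical L₂ →
  (∀ u v → Iff (lookup L₁ u ≡ lookup L₁ v) (lookup L₂ u ≡ lookup L₂ v)) → L₁ ≡ L₂
canonical-unique {n} {L₁ = L₁} {L₂} canonical₁ canonical₂ same-kernel = begin
  L₁                     ≡⟨ tabulate∘lookup L₁ ⟨
  tabulate (lookup L₁)   ≡⟨ tabulate-cong (λ v → agree n v (Fin.toℕ<n v)) ⟩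
  tabulate (lookup L₂)   ≡⟨ tabulate∘lookup L₂ ⟩
  L₂                     ∎
  where
  open ≡-Reasoning
  agree : ∀ b v → toℕ v < b → lookup L₁ v ≡ lookup L₂ v
  agree (suc b) v v≤b with Fin.<-cmp (lookup L₁ v) (lookup L₂ v)
  ... | tri≈ _ eq _ = eq
  ... | tri< l₁<l₂ _ _ with canonical₂ _ _ l₁<l₂ v refl
  ...   | u , u<v , l₂u≡l₁v = ⊥-elim (<-irrefl (cong toℕ l₁v≡l₂v) l₁<l₂)
    where
    l₁v≡l₂v : lookup L₁ v ≡ lookup L₂ v
    l₁v≡l₂v = trans (sym l₂u≡l₁v) (proj₁ (same-kernel u v) (trans (agree b u (<-≤-trans u<v (s≤s⁻¹ v≤b))) l₂u≡l₁v))
  agree (suc b) v v≤b | tri> _ _ l₂<l₁ with canonical₁ _ _ l₂<l₁ v refl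
  ...   | u , u<v , l₁u≡l₂v = ⊥-elim (<-irrefl (cong toℕ l₂v≡l₁v) l₂<l₁)
    where
    l₂v≡l₁v : lookup L₂ v ≡ lookup L₁ v
    l₂v≡l₁v = trans (sym l₁u≡l₂v) (proj₂ (same-kernel u v) (trans (sym (agree b u (<-≤-trans u<v (s≤s⁻¹ v≤b)))) l₁u≡l₂v))

weight-positive : ∀ {n m k} (ends : Ends n m) (pop : Fin n → ℕ) → Connected ends → {L : Vec (Fin k) n} →
  ValidPartition ends pop L → ∀ {w} → Weight ends pop L w → 0 < w
weight-positive ends pop connected {L} valid (wq , wd , quotient-count , district-counts , refl) =
  >-nonZero⁻¹ _ {{m*n≢0 wq _ {{>-nonZero wq>0}} {{product≢0 (map⁺ (tabulate⁺ λ i → >-nonZero (wd>0 i)))}}}}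
  where
  open Reachability ends
  open Labelling ends pop L
  wq>0 : 0 < wq
  wq>0 = count-positive quotient-count (proj₂ (SpanningTrees.spanning-tree-exists qends cross? (λ _ _ → tt , tt) quotient-spans))
    where
    quotient-spans : Spans qends All⊤ Cross
    quotient-spans i j _ _ with proj₁ valid i | proj₁ valid j
    ... | u , refl | v , refl = Reachability.reach-mono qends (λ _ → proj₂) (reach-quotient (connected u v tt tt))
  wd>0 : ∀ i → 0 < wd i
  wd>0 i = count-positive (district-counts i)
    (proj₂ (SpanningTrees.spanning-tree-exists ends (inside? i) (λ _ inside → inside) (proj₁ (proj₂ (proj₂ valid)) i)))

Z-positive : ∀ {n m k} (ends : Ends n m) (pop : Fin n → ℕ) → Connected ends → {L : Vec (Fin k) n} →
  ValidPartition ends pop L → ∀ {Z} → IsZ ends pop k Z → 0 < Z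
Z-positive ends pop connected {L} valid (zs , _ , zs⇔ , zs-weights , refl) with ∈-map⁻ proj₁ (proj₁ (zs⇔ L) valid)
... | _ , p∈zs , refl = <-≤-trans (weight-positive ends pop connected {L} valid (All.lookup zs-weights p∈zs)) (∈⇒≤sum (∈-map⁺ proj₂ p∈zs))

-- the accepted trees are partitioned according to the valid partition they output
count-accepted : ∀ {n m k} (ends : Ends n m) (pop : Fin n → ℕ) → (∀ v → 0 < pop v) → 1 ≤ k → Fin n →
  ∀ {Z} → IsZ ends pop k Z → Count (Accepted ends pop k) Z
count-accepted {k = k} ends pop pos k≥1 v₀ (zs , zs! , zs⇔ , zs-weights , refl) =
  count-cong (count-⋃ zs zs! counts disjoint) λ T → (λ (_ , _ , _ , accepted , _) → accepted) , reconstruct T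
  where
  OutputsValid : Vec (Fin k) _ → Subset _ → Set
  OutputsValid L T = ValidPartition ends pop L × Accepted ends pop k T × Outputs ends pop k T L

  valid-of : ∀ {p} → p ∈ₗ zs → ValidPartition ends pop (proj₁ p)
  valid-of p∈ = proj₂ (zs⇔ _) (∈-map⁺ proj₁ p∈)

  counts : All (λ (L , c) → Count (OutputsValid L) c) zs
  counts = All.tabulate λ {p} p∈ → count-cong
    (OutputCount.count-outputs ends pop pos k≥1 (proj₁ p) (valid-of p∈) (proj₂ p) (All.lookup zs-weights p∈))
    λ T → (valid-of p∈ ,_) , proj₂

  disjoint : ∀ {L₁ L₂ T} → OutputsValid L₁ T → OutputsValid L₂ T → L₁ ≡ L₂
  disjoint (valid₁ , _ , outputs₁) (valid₂ , _ , outputs₂) = canonical-unique (proj₁ (proj₂ valid₁)) (proj₁ (proj₂ valid₂))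
    λ u v → proj₁ (outputs₂ u v) ∘ proj₂ (outputs₁ u v) , proj₁ (outputs₁ u v) ∘ proj₂ (outputs₂ u v)

  reconstruct : ∀ T → Accepted ends pop k T → ∃ λ L → L ∈ₗ map proj₁ zs × OutputsValid L T
  reconstruct T accepted = L′ , proj₁ (zs⇔ L′) valid , valid , accepted , outputs
    where open Reconstruction ends pop pos k≥1 T accepted v₀

proposition1 : ∀ {n m k : ℕ} (ends : Ends n m) (pop : Fin n → ℕ) →
    Simple ends → Connected ends → (∀ v → 0 < pop v) → 1 ≤ k →
    (∃ λ (L′ : Vec (Fin k) n) → ValidPartition ends pop L′) →
    ∀ (L : Vec (Fin k) n) → ValidPartition ends pop L →
    ∀ (a b w Z : ℕ) →
    Count (λ T → Accepted ends pop k T × Outputs ends pop k T L) a →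
    Count (Accepted ends pop k) b →
    Weight ends pop L w →
    IsZ ends pop k Z →
    0 < b × 0 < Z × a * Z ≡ w * b
proposition1 ends pop _ connected pos k≥1 (L′ , L′-valid) L valid a b w Z outputs-L accepted weight isZ =
  subst (0 <_) (sym b≡Z) Z>0 , Z>0 , cong₂ _*_ a≡w (sym b≡Z)
  where
  a≡w : a ≡ w
  a≡w = count-unique outputs-L (OutputCount.count-outputs ends pop pos k≥1 L valid w weight) λ _ → id , id
  b≡Z : b ≡ Z
  b≡Z = count-unique accepted (count-accepted ends pop pos k≥1 (proj₁ (proj₁ L′-valid (fromℕ< k≥1))) isZ) λ _ → id , id
  Z>0 : 0 < Z
  Z>0 = Z-positive ends pop connected {L′} L′-valid isZ
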